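{- Let $p$ be an odd prime and $t=p-1$. Then there are at least $\binom{p}{2}^{p-1}$ good starting sets modulo $p$ (of size $2t$) contained in $\{1,\dots,p^2-1\}$.
   Context: For an odd prime $p$, $e_2:\mathbb{Z}\to\mathbb{Z}/p\mathbb{Z}$ is defined by $x^{p-1}\equiv 1+p\,e_2(x)\pmod{p^2}$ if $p\nmid x$ and $e_2(x)=0$ if $p\mid x$. A set $\{x_1,\dots,x_{2t}\}\subset\mathbb{Z}$ (with $1\le t\le p-1$) is a good starting set modulo $p$ if for every subset $\{\alpha_1,\dots,\alpha_t\}\subseteq\{0,\dots,p-2\}$ of $t$ distinct elements, $$\det\begin{pmatrix} x_1^{\alpha_1}&\cdots&x_1^{\alpha_t}& e_2(x_1)x_1^{\alpha_1}&\cdots& e_2(x_1)x_1^{\alpha_t}\\ \vdots&&\vdots&\vdots&&\vdots\\ x_{2t}^{\alpha_1}&\cdots&x_{2t}^{\alpha_t}& e_2(x_{2t})x_{2t}^{\alpha_1}&\cdots& e_2(x_{2t})x_{2t}^{\alpha_t}\end{pmatrix}\not\equiv 0\pmod p.$$ -}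

module Defs where

open import Data.Nat using (ℕ; zero; suc; _+_; _*_; _∸_; _^_; _≤_; _<_)
open import Data.Nat.DivMod using (_/_; _%_)
open import Data.Integer as ℤ using (ℤ; +_)
open import Data.Integer.Divisibility using () renaming (_∣_ to _∣ℤ_)
open import Data.Fin as Fin using (Fin; zero; suc; punchIn; splitAt; toℕ)
open import Data.Vec using (Vec; lookup)
open import Data.Sum using (inj₁; inj₂)
open import Data.Product using (_×_)
open import Relation.Nullary using (¬_)

-- For p ∤ x, x^(p-1) ≡ 1 + p · e₂ p x (mod p²);  e₂ p x = 0 if p ∣ x.
-- (The p = 0 clause is junk, only there to obtain NonZero p for the divisions.)
e₂ : ℕ → ℕ → ℕ
e₂ zero    x = 0
e₂ p@(suc _) x with x % p
... | zero  = 0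
... | suc _ = ((x ^ (p ∸ 1) ∸ 1) / p) % p

∑ : ∀ {n} → (Fin n → ℤ) → ℤ
∑ {zero}  f = + 0
∑ {suc n} f = f zero ℤ.+ ∑ (λ i → f (suc i))

sgn : ℕ → ℤ
sgn zero    = + 1
sgn (suc k) = ℤ.- sgn k

det : ∀ n → (Fin n → Fin n → ℤ) → ℤ
det zero    M = + 1
det (suc n) M = ∑ λ j → sgn (toℕ j) ℤ.* M zero j ℤ.* det n (λ i k → M (suc i) (punchIn j k))

-- strictly increasing vector (used to represent finite sets canonically)
Increasing : ∀ {n} → Vec ℕ n → Set
Increasing {n} v = ∀ (i j : Fin n) → i Fin.< j → lookup v i < lookup v j

goodMatrix : (p t : ℕ) → Vec ℕ (t + t) → Vec ℕ t → Fin (t + t) → Fin (t + t) → ℤ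
goodMatrix p t xs α i j with splitAt t j
... | inj₁ a = + (lookup xs i ^ lookup α a)
... | inj₂ a = + (e₂ p (lookup xs i) * lookup xs i ^ lookup α a)

GoodStartingSet : (p t : ℕ) → Vec ℕ (t + t) → Set
GoodStartingSet p t xs =
  ∀ (α : Vec ℕ t) → Increasing α → (∀ a → lookup α a < p ∸ 1) →
  ¬ ((+ p) ∣ℤ det (t + t) (goodMatrix p t xs α))

module Submission where

-- For each residue r ∈ {1, …, p − 1} choose two of its p lifts r + k p ∈ [1, p²); the C(p,2)^(p−1)
-- choices give distinct sets.  Since (r + k p)^(p−1) ≡ r^(p−1) + (p − 1) k p r^(p−2) (mod p²), the two
-- chosen lifts of r have Fermat quotients that differ mod p.  For t = p − 1 the exponents must be
-- 0, …, p − 2, and the orthogonality relations ∑_{a<p−1} (x₀⁻¹ x)^a ≡ −[x ≡ x₀] (mod p) turn a vanishing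
-- combination l of the rows into l_y + l_z ≡ 0 and l_y e₂(y) + l_z e₂(z) ≡ 0 on each pair {y, z}.  So the
-- rows are independent mod p, and Gaussian elimination by column operations shows that p ∤ det.

open import Defs
open import Data.Nat as ℕ using (ℕ; zero; suc; z≤n; s≤s)
import Data.Nat.Properties as ℕP
open import Data.Integer as ℤ using (ℤ; +_; 0ℤ; 1ℤ)
import Data.Integer.Properties as ℤP
open import Data.Fin as Fin using (Fin; zero; suc; toℕ; punchIn; punchOut; inject₁)
import Data.Fin.Properties as FinP
open import Data.Product using (Σ; ∃; _×_; _,_; proj₁; proj₂)
open import Data.Sum using (_⊎_; inj₁; inj₂; [_,_]′)
open import Data.Empty using (⊥-elim)
open import Relation.Nullary using (¬_; yes; no)
open import Relation.Binary.Definitions using (tri<; tri≈; tri>)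
open import Data.Nat.Primality using (Prime; euclidsLemma; ¬prime[1])
open import Relation.Binary.PropositionalEquality
open import Function using (_∘_; id)

module Congruence where

  open import Data.Integer using (_+_; _*_; -_; _-_; _^_)
  open import Data.Integer.Divisibility.Signed
  open import Data.Integer.Solver using (module +-*-Solver)
  import Data.Nat.Divisibility as ℕD
  open import Relation.Binary.Bundles using (Setoid)
  open +-*-Solver

  infix 4 _≡_mod_

  record _≡_mod_ (a b : ℤ) (m : ℕ) : Set where
    constructor ∣⇒≡mod
    field ≡mod⇒∣ : + m ∣ a - b

  open _≡_mod_ public

  module _ {m : ℕ} where

    private
      ∣-by : ∀ {a b} → a ≡ b → + m ∣ a → + m ∣ b
      ∣-by = subst (+ m ∣_)

    refl-mod : ∀ {a} → a ≡ a mod m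
    refl-mod {a} = ∣⇒≡mod (∣-by (sym (ℤP.+-inverseʳ a)) (∣n⇒∣m*n 0ℤ ∣-refl))

    reflexive-mod : ∀ {a b} → a ≡ b → a ≡ b mod m
    reflexive-mod refl = refl-mod

    sym-mod : ∀ {a b} → a ≡ b mod m → b ≡ a mod m
    sym-mod {a} {b} (∣⇒≡mod d) =
      ∣⇒≡mod (∣-by (solve 2 (λ a b → :- (a :- b) := b :- a) refl a b) (∣m⇒∣-m d))

    trans-mod : ∀ {a b c} → a ≡ b mod m → b ≡ c mod m → a ≡ c mod m
    trans-mod {a} {b} {c} (∣⇒≡mod d) (∣⇒≡mod e) =
      ∣⇒≡mod (∣-by (solve 3 (λ a b c → (a :- b) :+ (b :- c) := a :- c) refl a b c) (∣m∣n⇒∣m+n d e))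

    +-cong-mod : ∀ {a b c d} → a ≡ b mod m → c ≡ d mod m → a + c ≡ b + d mod m
    +-cong-mod {a} {b} {c} {d} (∣⇒≡mod e) (∣⇒≡mod f) =
      ∣⇒≡mod (∣-by (solve 4 (λ a b c d → (a :- b) :+ (c :- d) := (a :+ c) :- (b :+ d)) refl a b c d)
                      (∣m∣n⇒∣m+n e f))

    neg-cong-mod : ∀ {a b} → a ≡ b mod m → - a ≡ - b mod m
    neg-cong-mod {a} {b} (∣⇒≡mod e) =
      ∣⇒≡mod (∣-by (solve 2 (λ a b → :- (a :- b) := (:- a) :- (:- b)) refl a b) (∣m⇒∣-m e))

    *-cong-mod : ∀ {a b c d} → a ≡ b mod m → c ≡ d mod m → a * c ≡ b * d mod m
    *-cong-mod {a} {b} {c} {d} (∣⇒≡mod e) (∣⇒≡mod f) =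
      ∣⇒≡mod (∣-by (solve 4 (λ a b c d → c :* (a :- b) :+ b :* (c :- d) := a :* c :- b :* d) refl a b c d)
                      (∣m∣n⇒∣m+n (∣n⇒∣m*n c e) (∣n⇒∣m*n b f)))

    ^-cong-mod : ∀ {a b} n → a ≡ b mod m → a ^ n ≡ b ^ n mod m
    ^-cong-mod zero    e = refl-mod
    ^-cong-mod (suc n) e = *-cong-mod e (^-cong-mod n e)

    ∣⇒≡0-mod : ∀ {a} → + m ∣ a → a ≡ 0ℤ mod m
    ∣⇒≡0-mod {a} d = ∣⇒≡mod (∣-by (sym (ℤP.+-identityʳ a)) d)

    ≡0-mod⇒∣ : ∀ {a} → a ≡ 0ℤ mod m → + m ∣ a
    ≡0-mod⇒∣ {a} (∣⇒≡mod d) = ∣-by (ℤP.+-identityʳ a) d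

    ∣-resp-mod : ∀ {a b} → a ≡ b mod m → + m ∣ a → + m ∣ b
    ∣-resp-mod {a} {b} (∣⇒≡mod e) d = ∣-by (solve 2 (λ a b → a :- (a :- b) := b) refl a b) (∣m∣n⇒∣m-n d e)

    multiple≡0-mod : ∀ k → k * + m ≡ 0ℤ mod m
    multiple≡0-mod k = ∣⇒≡0-mod (∣n⇒∣m*n k ∣-refl)

  ≡mod0⇒≡ : ∀ {a b} → a ≡ b mod 0 → a ≡ b
  ≡mod0⇒≡ {a} {b} (∣⇒≡mod 0∣a-b) = begin
    a              ≡⟨ solve 2 (λ a b → a := (a :- b) :+ b) refl a b ⟩
    (a - b) + b    ≡⟨ cong (_+ b) (0∣⇒≡0 0∣a-b) ⟩
    0ℤ + b         ≡⟨ ℤP.+-identityˡ b ⟩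
    b              ∎
    where open ≡-Reasoning

  *-cancelˡ-mod : ∀ {m m′ a b} .{{_ : ℕ.NonZero m}} → + m * a ≡ + m * b mod (m ℕ.* m′) → a ≡ b mod m′
  *-cancelˡ-mod {m} {m′} {a} {b} (∣⇒≡mod mm′∣) = ∣⇒≡mod (*-cancelˡ-∣ (+ m)
    (subst₂ _∣_ (ℤP.pos-* m m′) (solve 3 (λ m a b → m :* a :- m :* b := m :* (a :- b)) refl (+ m) a b) mm′∣))

  private
    ∣∧<⇒≡0 : ∀ {m d} → m ℕD.∣ d → d ℕ.< m → d ≡ 0
    ∣∧<⇒≡0 {d = zero}  _   _   = refl
    ∣∧<⇒≡0 {d = suc _} m∣d d<m = ⊥-elim (ℕP.<⇒≱ d<m (ℕD.∣⇒≤ m∣d))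

    ∣difference⇒≡ : ∀ {m k k′} → k ℕ.< m → k′ ℕ.≤ k → + m ∣ + k - + k′ → k ≡ k′
    ∣difference⇒≡ {m} {k} {k′} k<m k′≤k m∣k-k′ =
      ℕP.≤-antisym (ℕP.m∸n≡0⇒m≤n (∣∧<⇒≡0 m∣k∸k′ (ℕP.≤-<-trans (ℕP.m∸n≤m k k′) k<m))) k′≤k
      where
      m∣k∸k′ : m ℕD.∣ k ℕ.∸ k′
      m∣k∸k′ = ∣⇒∣ᵤ (subst (+ m ∣_) (trans (ℤP.m-n≡m⊖n k k′) (ℤP.⊖-≥ k′≤k)) m∣k-k′)

  ≡mod⇒≡-below : ∀ {m k k′} → k ℕ.< m → k′ ℕ.< m → + k ≡ + k′ mod m → k ≡ k′
  ≡mod⇒≡-below {k = k} {k′} k<m k′<m k≡k′ with ℕP.≤-total k′ k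
  ... | inj₁ k′≤k = ∣difference⇒≡ k<m k′≤k (≡mod⇒∣ k≡k′)
  ... | inj₂ k≤k′ = sym (∣difference⇒≡ k′<m k≤k′ (≡mod⇒∣ (sym-mod k≡k′)))

  mod-setoid : ℕ → Setoid _ _
  mod-setoid m = record
    { Carrier = ℤ
    ; _≈_ = λ a b → a ≡ b mod m
    ; isEquivalence = record { refl = refl-mod ; sym = sym-mod ; trans = trans-mod }
    }

  module ≡-mod-Reasoning (m : ℕ) where
    open import Relation.Binary.Reasoning.Setoid (mod-setoid m) public

module Sums where

  open import Data.Integer using (_+_; _*_; _-_; _^_)
  open import Data.Integer.Solver using (module +-*-Solver)
  open +-*-Solver
  open Congruence

  ∑-cong : ∀ {n} {f g : Fin n → ℤ} → (∀ i → f i ≡ g i) → ∑ f ≡ ∑ g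
  ∑-cong {zero}  e = refl
  ∑-cong {suc n} e = cong₂ _+_ (e zero) (∑-cong (λ i → e (suc i)))

  ∑-cong-mod : ∀ {m n} {f g : Fin n → ℤ} → (∀ i → f i ≡ g i mod m) → ∑ f ≡ ∑ g mod m
  ∑-cong-mod {n = zero}  e = refl-mod
  ∑-cong-mod {n = suc n} e = +-cong-mod (e zero) (∑-cong-mod (λ i → e (suc i)))

  ∑-zero : ∀ {n} (f : Fin n → ℤ) → (∀ i → f i ≡ 0ℤ) → ∑ f ≡ 0ℤ
  ∑-zero {zero}  f e = refl
  ∑-zero {suc n} f e = cong₂ _+_ (e zero) (∑-zero (λ i → f (suc i)) (λ i → e (suc i)))

  ∑-const : ∀ n c → ∑ {n} (λ _ → c) ≡ + n * c
  ∑-const zero    c = sym (ℤP.*-zeroˡ c)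
  ∑-const (suc n) c = begin
    c + ∑ {n} (λ _ → c)  ≡⟨ cong (_+_ c) (∑-const n c) ⟩
    c + + n * c          ≡⟨ sym (ℤP.suc-* (+ n) c) ⟩
    + suc n * c          ∎
    where open ≡-Reasoning

  ∑-distrib-+ : ∀ {n} (f g : Fin n → ℤ) → ∑ (λ i → f i + g i) ≡ ∑ f + ∑ g
  ∑-distrib-+ {zero}  f g = refl
  ∑-distrib-+ {suc n} f g =
    trans (cong (_+_ (f zero + g zero)) (∑-distrib-+ (λ i → f (suc i)) (λ i → g (suc i))))
          (+-interchange (f zero) (g zero) _ _)
    where open import Algebra.Properties.CommutativeSemigroup ℤP.+-commutativeSemigroup
            using () renaming (interchange to +-interchange)

  *-distribˡ-∑ : ∀ {n} c (f : Fin n → ℤ) → c * ∑ f ≡ ∑ (λ i → c * f i)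
  *-distribˡ-∑ {zero}  c f = ℤP.*-zeroʳ c
  *-distribˡ-∑ {suc n} c f =
    trans (ℤP.*-distribˡ-+ c (f zero) _) (cong (_+_ (c * f zero)) (*-distribˡ-∑ c (λ i → f (suc i))))

  ∑-linear : ∀ {n} (l x y : Fin n → ℤ) u v →
    ∑ (λ i → l i * (u * x i + v * y i)) ≡ u * ∑ (λ i → l i * x i) + v * ∑ (λ i → l i * y i)
  ∑-linear l x y u v = begin
    ∑ (λ i → l i * (u * x i + v * y i))
      ≡⟨ ∑-cong (λ i → solve 5 (λ l u x v y → l :* (u :* x :+ v :* y) := u :* (l :* x) :+ v :* (l :* y))
                               refl (l i) u (x i) v (y i)) ⟩
    ∑ (λ i → u * (l i * x i) + v * (l i * y i))
      ≡⟨ ∑-distrib-+ (λ i → u * (l i * x i)) (λ i → v * (l i * y i)) ⟩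
    ∑ (λ i → u * (l i * x i)) + ∑ (λ i → v * (l i * y i))
      ≡⟨ sym (cong₂ _+_ (*-distribˡ-∑ u (λ i → l i * x i)) (*-distribˡ-∑ v (λ i → l i * y i))) ⟩
    u * ∑ (λ i → l i * x i) + v * ∑ (λ i → l i * y i) ∎
    where open ≡-Reasoning

  ∑-comm : ∀ {m n} (f : Fin m → Fin n → ℤ) → ∑ (λ i → ∑ (f i)) ≡ ∑ (λ j → ∑ (λ i → f i j))
  ∑-comm {zero} {n} f = sym (∑-zero {n} _ (λ _ → refl))
  ∑-comm {suc m} f =
    trans (cong (_+_ (∑ (f zero))) (∑-comm (λ i → f (suc i))))
          (sym (∑-distrib-+ (f zero) (λ j → ∑ (λ i → f (suc i) j))))

  ∑-support₁-mod : ∀ {m n} (f : Fin n → ℤ) a → (∀ i → i ≢ a → f i ≡ 0ℤ mod m) → ∑ f ≡ f a mod m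
  ∑-support₁-mod {m} {suc n} f zero e = begin
    f zero + ∑ (λ i → f (suc i))
      ≈⟨ +-cong-mod (refl-mod {a = f zero}) (∑-cong-mod (λ i → e (suc i) (λ ()))) ⟩
    f zero + ∑ {n} (λ _ → 0ℤ)
      ≡⟨ trans (cong (_+_ (f zero)) (∑-zero {n} _ (λ _ → refl))) (ℤP.+-identityʳ (f zero)) ⟩
    f zero                        ∎
    where open ≡-mod-Reasoning m
  ∑-support₁-mod {m} f (suc a) e = begin
    f zero + ∑ (λ i → f (suc i))
      ≈⟨ +-cong-mod (e zero (λ ()))
                    (∑-support₁-mod (λ i → f (suc i)) a (λ i i≢a → e (suc i) (i≢a ∘ FinP.suc-injective))) ⟩
    0ℤ + f (suc a)
      ≡⟨ ℤP.+-identityˡ (f (suc a)) ⟩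
    f (suc a)                     ∎
    where open ≡-mod-Reasoning m

  ∑-support₂-mod : ∀ {m n} (f : Fin n → ℤ) {a b} → a ≢ b → (∀ i → i ≢ a → i ≢ b → f i ≡ 0ℤ mod m) →
    ∑ f ≡ f a + f b mod m
  ∑-support₂-mod f {zero}  {zero}  a≢b e = ⊥-elim (a≢b refl)
  ∑-support₂-mod f {zero}  {suc b} a≢b e =
    +-cong-mod (refl-mod {a = f zero}) (∑-support₁-mod _ b (λ i i≢b → e (suc i) (λ ()) (i≢b ∘ FinP.suc-injective)))
  ∑-support₂-mod f {suc a} {zero}  a≢b e =
    trans-mod (+-cong-mod (refl-mod {a = f zero})
                          (∑-support₁-mod _ a (λ i i≢a → e (suc i) (i≢a ∘ FinP.suc-injective) (λ ()))))
              (reflexive-mod (ℤP.+-comm (f zero) (f (suc a))))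
  ∑-support₂-mod {m} f {suc a} {suc b} a≢b e = begin
    f zero + ∑ (λ i → f (suc i))
      ≈⟨ +-cong-mod (e zero (λ ()) (λ ()))
                    (∑-support₂-mod (λ i → f (suc i)) (a≢b ∘ cong suc)
                       (λ i i≢a i≢b → e (suc i) (i≢a ∘ FinP.suc-injective) (i≢b ∘ FinP.suc-injective))) ⟩
    0ℤ + (f (suc a) + f (suc b))
      ≡⟨ ℤP.+-identityˡ _ ⟩
    f (suc a) + f (suc b)         ∎
    where open ≡-mod-Reasoning m

  ∑-support₁ : ∀ {n} (f : Fin n → ℤ) a → (∀ i → i ≢ a → f i ≡ 0ℤ) → ∑ f ≡ f a
  ∑-support₁ f a e = ≡mod0⇒≡ (∑-support₁-mod f a (λ i i≢a → reflexive-mod (e i i≢a)))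

  ∑-support₂ : ∀ {n} (f : Fin n → ℤ) {a b} → a ≢ b → (∀ i → i ≢ a → i ≢ b → f i ≡ 0ℤ) →
    ∑ f ≡ f a + f b
  ∑-support₂ f a≢b e = ≡mod0⇒≡ (∑-support₂-mod f a≢b (λ i i≢a i≢b → reflexive-mod (e i i≢a i≢b)))

  geometric-sum : ∀ u n → (u - 1ℤ) * ∑ {n} (λ a → u ^ toℕ a) ≡ u ^ n - 1ℤ
  geometric-sum u zero    = ℤP.*-zeroʳ (u - 1ℤ)
  geometric-sum u (suc n) = begin
    (u - 1ℤ) * (1ℤ + ∑ {n} (λ a → u * u ^ toℕ a))
      ≡⟨ cong (λ s → (u - 1ℤ) * (1ℤ + s)) (sym (*-distribˡ-∑ {n} u (λ a → u ^ toℕ a))) ⟩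
    (u - 1ℤ) * (1ℤ + u * S)
      ≡⟨ solve 2 (λ u s → (u :- con 1ℤ) :* (con 1ℤ :+ u :* s) := u :* ((u :- con 1ℤ) :* s) :+ u :- con 1ℤ)
                 refl u S ⟩
    u * ((u - 1ℤ) * S) + u - 1ℤ
      ≡⟨ cong (λ z → u * z + u - 1ℤ) (geometric-sum u n) ⟩
    u * (u ^ n - 1ℤ) + u - 1ℤ
      ≡⟨ solve 2 (λ u v → u :* (v :- con 1ℤ) :+ u :- con 1ℤ := u :* v :- con 1ℤ) refl u (u ^ n) ⟩
    u * u ^ n - 1ℤ                             ∎
    where
    open ≡-Reasoning
    S : ℤ
    S = ∑ {n} (λ a → u ^ toℕ a)

module Determinants where

  open import Data.Integer using (_+_; _*_; -_)
  open import Data.Integer.Solver using (module +-*-Solver)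
  open import Data.Vec.Functional using (updateAt)
  open import Data.Vec.Functional.Properties
    using (updateAt-updates; updateAt-minimal; updateAt-id-local; updateAt-commutes)
  open import Function using (const)
  open +-*-Solver
  open Sums

  Matrix : ℕ → Set
  Matrix n = Fin n → Fin n → ℤ

  minor : ∀ {n} → Matrix (suc n) → Fin (suc n) → Matrix n
  minor M j i k = M (suc i) (punchIn j k)

  laplaceTerm : ∀ {n} → Matrix (suc n) → Fin (suc n) → ℤ
  laplaceTerm {n} M m = sgn (toℕ m) * M zero m * det n (minor M m)

  setColumn : ∀ {n} → Matrix n → Fin n → (Fin n → ℤ) → Matrix n
  setColumn M k x i = updateAt (M i) k (const (x i))

  setColumn-updates : ∀ {n} (M : Matrix n) k x i → setColumn M k x i k ≡ x i
  setColumn-updates M k x i = updateAt-updates k (M i)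

  setColumn-minimal : ∀ {n} (M : Matrix n) {k l} x i → l ≢ k → setColumn M k x i l ≡ M i l
  setColumn-minimal M {k} {l} x i = updateAt-minimal l k (M i)

  setColumn-cong : ∀ {n} (M : Matrix n) k {x y : Fin n → ℤ} → (∀ i → x i ≡ y i) → ∀ i j →
    setColumn M k x i j ≡ setColumn M k y i j
  setColumn-cong M k e i j = cong (λ v → updateAt (M i) k (const v) j) (e i)

  setColumn-id : ∀ {n} (M : Matrix n) k i l → setColumn M k (λ i → M i k) i l ≡ M i l
  setColumn-id M k i = updateAt-id-local k (M i) refl

  setColumn-comm : ∀ {n} (M : Matrix n) {k l} x y → k ≢ l → ∀ i j →
    setColumn (setColumn M k x) l y i j ≡ setColumn (setColumn M l y) k x i j
  setColumn-comm M {k} {l} x y k≢l i = updateAt-commutes l k (k≢l ∘ sym) (M i)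

  det-cong : ∀ n {M N : Matrix n} → (∀ i j → M i j ≡ N i j) → det n M ≡ det n N
  det-cong zero    e = refl
  det-cong (suc n) e = ∑-cong λ j →
    cong₂ (λ a d → sgn (toℕ j) * a * d) (e zero j) (det-cong n (λ i k → e (suc i) (punchIn j k)))

  minor-setColumn-same : ∀ {n} (M : Matrix (suc n)) k x i l → minor (setColumn M k x) k i l ≡ minor M k i l
  minor-setColumn-same M k x i l = setColumn-minimal M x (suc i) (FinP.punchInᵢ≢i k l)

  minor-setColumn-other : ∀ {n} (M : Matrix (suc n)) {m k} (m≢k : m ≢ k) x i l →
    minor (setColumn M k x) m i l ≡ setColumn (minor M m) (punchOut m≢k) (x ∘ suc) i l
  minor-setColumn-other M {m} {k} m≢k x i l with l Fin.≟ punchOut m≢k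
  ... | yes refl = trans (cong (setColumn M k x (suc i)) (FinP.punchIn-punchOut m≢k))
                         (trans (setColumn-updates M k x (suc i)) (sym (setColumn-updates (minor M m) _ (x ∘ suc) i)))
  ... | no l≢k′ = trans (setColumn-minimal M x (suc i) punchIn≢k) (sym (setColumn-minimal (minor M m) (x ∘ suc) i l≢k′))
    where
    punchIn≢k : punchIn m l ≢ k
    punchIn≢k e = l≢k′ (FinP.punchIn-injective m l _ (trans e (sym (FinP.punchIn-punchOut m≢k))))

  det-linear : ∀ n (M : Matrix n) k (u v : ℤ) (x y : Fin n → ℤ) →
    det n (setColumn M k (λ i → u * x i + v * y i)) ≡ u * det n (setColumn M k x) + v * det n (setColumn M k y)
  det-linear zero    M () u v x y
  det-linear (suc n) M k u v x y = begin
    ∑ (laplaceTerm P)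
      ≡⟨ ∑-cong termwise ⟩
    ∑ (λ m → u * laplaceTerm Mx m + v * laplaceTerm My m)
      ≡⟨ ∑-distrib-+ (λ m → u * laplaceTerm Mx m) (λ m → v * laplaceTerm My m) ⟩
    ∑ (λ m → u * laplaceTerm Mx m) + ∑ (λ m → v * laplaceTerm My m)
      ≡⟨ sym (cong₂ _+_ (*-distribˡ-∑ u (laplaceTerm Mx)) (*-distribˡ-∑ v (laplaceTerm My))) ⟩
    u * det (suc n) Mx + v * det (suc n) My ∎
    where
    open ≡-Reasoning
    w : Fin (suc n) → ℤ
    w i = u * x i + v * y i
    P Mx My : Matrix (suc n)
    P  = setColumn M k w
    Mx = setColumn M k x
    My = setColumn M k y
    termwise : ∀ m → laplaceTerm P m ≡ u * laplaceTerm Mx m + v * laplaceTerm My m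
    termwise m with m Fin.≟ k
    ... | yes refl = begin
      sgn (toℕ m) * P zero m * det n (minor P m)
        ≡⟨ same-column w ⟩
      sgn (toℕ m) * (u * x zero + v * y zero) * D
        ≡⟨ solve 6 (λ s u v a b d → s :* (u :* a :+ v :* b) :* d := u :* (s :* a :* d) :+ v :* (s :* b :* d))
                   refl (sgn (toℕ m)) u v (x zero) (y zero) D ⟩
      u * (sgn (toℕ m) * x zero * D) + v * (sgn (toℕ m) * y zero * D)
        ≡⟨ sym (cong₂ (λ a b → u * a + v * b) (same-column x) (same-column y)) ⟩
      u * laplaceTerm Mx m + v * laplaceTerm My m ∎
      where
      D = det n (minor M m)
      same-column : ∀ z → laplaceTerm (setColumn M m z) m ≡ sgn (toℕ m) * z zero * D
      same-column z = cong₂ (λ a d → sgn (toℕ m) * a * d)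
                            (setColumn-updates M m z zero) (det-cong n (minor-setColumn-same M m z))
    ... | no m≢k = begin
      sgn (toℕ m) * P zero m * det n (minor P m)
        ≡⟨ other-column w ⟩
      sgn (toℕ m) * M zero m * det n (setColumn (minor M m) k′ (w ∘ suc))
        ≡⟨ cong (sgn (toℕ m) * M zero m *_) (det-linear n (minor M m) k′ u v (x ∘ suc) (y ∘ suc)) ⟩
      sgn (toℕ m) * M zero m * (u * Dx + v * Dy)
        ≡⟨ solve 6 (λ s a u v c d → s :* a :* (u :* c :+ v :* d) := u :* (s :* a :* c) :+ v :* (s :* a :* d))
                   refl (sgn (toℕ m)) (M zero m) u v Dx Dy ⟩
      u * (sgn (toℕ m) * M zero m * Dx) + v * (sgn (toℕ m) * M zero m * Dy)
        ≡⟨ sym (cong₂ (λ a b → u * a + v * b) (other-column x) (other-column y)) ⟩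
      u * laplaceTerm Mx m + v * laplaceTerm My m ∎
      where
      k′ : Fin n
      k′ = punchOut m≢k
      Dx Dy : ℤ
      Dx = det n (setColumn (minor M m) k′ (x ∘ suc))
      Dy = det n (setColumn (minor M m) k′ (y ∘ suc))
      other-column : ∀ z →
        laplaceTerm (setColumn M k z) m ≡ sgn (toℕ m) * M zero m * det n (setColumn (minor M m) k′ (z ∘ suc))
      other-column z = cong₂ (λ a d → sgn (toℕ m) * a * d)
                             (setColumn-minimal M z zero m≢k) (det-cong n (minor-setColumn-other M m≢k z))

  punchIn-adjacent : ∀ {n} (c k : Fin n) →
    punchIn (inject₁ c) k ≡ punchIn (suc c) k ⊎ (punchIn (inject₁ c) k ≡ suc c × punchIn (suc c) k ≡ inject₁ c)
  punchIn-adjacent zero    zero    = inj₂ (refl , refl)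
  punchIn-adjacent zero    (suc k) = inj₁ refl
  punchIn-adjacent (suc c) zero    = inj₁ refl
  punchIn-adjacent (suc c) (suc k) with punchIn-adjacent c k
  ... | inj₁ e       = inj₁ (cong suc e)
  ... | inj₂ (e , f) = inj₂ (cong suc e , cong suc f)

  punchOut-adjacent : ∀ {n} {m : Fin (suc (suc n))} {c : Fin (suc n)} → m ≢ inject₁ c → m ≢ suc c →
    ∃ λ c′ → punchIn m (inject₁ c′) ≡ inject₁ c × punchIn m (suc c′) ≡ suc c
  punchOut-adjacent {m = zero}          {zero}   m≢a m≢b = ⊥-elim (m≢a refl)
  punchOut-adjacent {m = zero}          {suc c}  m≢a m≢b = c , refl , refl
  punchOut-adjacent {m = suc zero}      {zero}   m≢a m≢b = ⊥-elim (m≢b refl)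
  punchOut-adjacent {n = suc n} {suc (suc m)} {zero} m≢a m≢b = zero , refl , refl
  punchOut-adjacent {n = suc n} {suc m} {suc c} m≢a m≢b
    with punchOut-adjacent {m = m} {c} (m≢a ∘ cong suc) (m≢b ∘ cong suc)
  ... | c′ , e , f = suc c′ , cong suc e , cong suc f

  inject₁≢suc : ∀ {n} (c : Fin n) → inject₁ c ≢ suc c
  inject₁≢suc c e = ℕP.1+n≢n (trans (sym (cong toℕ e)) (FinP.toℕ-inject₁ c))

  -- The terms at the two equal columns cancel since their minors agree; every other minor again has
  -- two adjacent equal columns.
  det-adjacent-equal-columns : ∀ n (M : Matrix (suc n)) c →
    (∀ i → M i (inject₁ c) ≡ M i (suc c)) → det (suc n) M ≡ 0ℤ
  det-adjacent-equal-columns (suc n) M c e = begin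
    det (suc (suc n)) M                 ≡⟨ ∑-support₂ term (inject₁≢suc c) others ⟩
    term (inject₁ c) + term (suc c)      ≡⟨ cong (_+_ (term (inject₁ c))) term-suc ⟩
    term (inject₁ c) + - term (inject₁ c) ≡⟨ ℤP.+-inverseʳ (term (inject₁ c)) ⟩
    0ℤ ∎
    where
    open ≡-Reasoning
    term = laplaceTerm M
    equal-minors : ∀ i k → minor M (suc c) i k ≡ minor M (inject₁ c) i k
    equal-minors i k with punchIn-adjacent c k
    ... | inj₁ same = cong (M (suc i)) (sym same)
    ... | inj₂ (a↦b , b↦a) = trans (cong (M (suc i)) b↦a) (trans (e (suc i)) (cong (M (suc i)) (sym a↦b)))
    term-suc : term (suc c) ≡ - term (inject₁ c)
    term-suc = begin
      - sgn (toℕ c) * M zero (suc c) * det (suc n) (minor M (suc c))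
        ≡⟨ cong₂ (λ s a → - s * a * det (suc n) (minor M (suc c)))
                 (cong sgn (sym (FinP.toℕ-inject₁ c))) (sym (e zero)) ⟩
      - sgn (toℕ (inject₁ c)) * M zero (inject₁ c) * det (suc n) (minor M (suc c))
        ≡⟨ cong (- sgn (toℕ (inject₁ c)) * M zero (inject₁ c) *_) (det-cong (suc n) equal-minors) ⟩
      - sgn (toℕ (inject₁ c)) * M zero (inject₁ c) * det (suc n) (minor M (inject₁ c))
        ≡⟨ solve 3 (λ s a d → (:- s) :* a :* d := :- (s :* a :* d))
                   refl (sgn (toℕ (inject₁ c))) (M zero (inject₁ c)) (det (suc n) (minor M (inject₁ c))) ⟩
      - term (inject₁ c) ∎
    others : ∀ m → m ≢ inject₁ c → m ≢ suc c → term m ≡ 0ℤ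
    others m m≢a m≢b with punchOut-adjacent m≢a m≢b
    ... | c′ , a′↦a , b′↦b =
      trans (cong (sgn (toℕ m) * M zero m *_)
                  (det-adjacent-equal-columns n (minor M m) c′
                     (λ i → trans (cong (M (suc i)) a′↦a) (trans (e (suc i)) (cong (M (suc i)) (sym b′↦b))))))
            (ℤP.*-zeroʳ (sgn (toℕ m) * M zero m))

  det-additive : ∀ n (M : Matrix n) k (x y : Fin n → ℤ) →
    det n (setColumn M k (λ i → x i + y i)) ≡ det n (setColumn M k x) + det n (setColumn M k y)
  det-additive n M k x y = begin
    det n (setColumn M k (λ i → x i + y i))
      ≡⟨ det-cong n (setColumn-cong M k (λ i → sym (cong₂ _+_ (ℤP.*-identityˡ (x i)) (ℤP.*-identityˡ (y i))))) ⟩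
    det n (setColumn M k (λ i → 1ℤ * x i + 1ℤ * y i))
      ≡⟨ det-linear n M k 1ℤ 1ℤ x y ⟩
    1ℤ * det n (setColumn M k x) + 1ℤ * det n (setColumn M k y)
      ≡⟨ cong₂ _+_ (ℤP.*-identityˡ (det n (setColumn M k x))) (ℤP.*-identityˡ (det n (setColumn M k y))) ⟩
    det n (setColumn M k x) + det n (setColumn M k y) ∎
    where open ≡-Reasoning

  swapColumns : ∀ {n} → Matrix n → Fin n → Fin n → Matrix n
  swapColumns M a b = setColumn (setColumn M a (λ i → M i b)) b (λ i → M i a)

  -- D x y (columns a, b replaced by x, y) is additive in x and in y and vanishes for x = y, hence
  -- D a b + D b a = D (a + b) (a + b) − D a a − D b b = 0.
  det-swap-adjacent-columns : ∀ n (M : Matrix (suc n)) c →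
    det (suc n) (swapColumns M (inject₁ c) (suc c)) ≡ - det (suc n) M
  det-swap-adjacent-columns n M c = +-inverseʳ-unique (det (suc n) M) _ (begin
    det (suc n) M + det (suc n) (swapColumns M a b)
      ≡⟨ sym (cong₂ _+_ (det-cong (suc n) D-own) refl) ⟩
    D (col a) (col b) + D (col b) (col a)
      ≡⟨ sym (cong₂ _+_ (trans (cong (_+ D (col a) (col b)) (D-diagonal (col a))) (ℤP.+-identityˡ (D (col a) (col b))))
                        (trans (cong (_+_ (D (col b) (col a))) (D-diagonal (col b))) (ℤP.+-identityʳ (D (col b) (col a))))) ⟩
    (D (col a) (col a) + D (col a) (col b)) + (D (col b) (col a) + D (col b) (col b))
      ≡⟨ sym (cong₂ _+_ (D-additiveʳ (col a) (col a) (col b)) (D-additiveʳ (col b) (col a) (col b))) ⟩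
    D (col a) s + D (col b) s
      ≡⟨ sym (D-additiveˡ (col a) (col b) s) ⟩
    D s s
      ≡⟨ D-diagonal s ⟩
    0ℤ ∎)
    where
    open ≡-Reasoning
    open import Algebra.Properties.AbelianGroup ℤP.+-0-abelianGroup using () renaming (inverseʳ-unique to +-inverseʳ-unique)
    a b : Fin (suc n)
    a = inject₁ c
    b = suc c
    a≢b = inject₁≢suc c
    col : Fin (suc n) → Fin (suc n) → ℤ
    col k i = M i k
    s : Fin (suc n) → ℤ
    s i = col a i + col b i
    D : (x y : Fin (suc n) → ℤ) → ℤ
    D x y = det (suc n) (setColumn (setColumn M a x) b y)
    D-own : ∀ i j → setColumn (setColumn M a (col a)) b (col b) i j ≡ M i j
    D-own i j = trans (setColumn-cong (setColumn M a (col a)) b (λ i → sym (setColumn-minimal M (col a) i (a≢b ∘ sym))) i j)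
                      (trans (setColumn-id (setColumn M a (col a)) b i j) (setColumn-id M a i j))
    D-diagonal : ∀ x → D x x ≡ 0ℤ
    D-diagonal x = det-adjacent-equal-columns n (setColumn (setColumn M a x) b x) c λ i →
      trans (setColumn-minimal (setColumn M a x) x i a≢b)
            (trans (setColumn-updates M a x i) (sym (setColumn-updates (setColumn M a x) b x i)))
    D-additiveʳ : ∀ x y z → D x (λ i → y i + z i) ≡ D x y + D x z
    D-additiveʳ x = det-additive (suc n) (setColumn M a x) b
    D-additiveˡ : ∀ x y z → D (λ i → x i + y i) z ≡ D x z + D y z
    D-additiveˡ x y z = begin
      D (λ i → x i + y i) z
        ≡⟨ swap-order (λ i → x i + y i) ⟩
      det (suc n) (setColumn (setColumn M b z) a (λ i → x i + y i))
        ≡⟨ det-additive (suc n) (setColumn M b z) a x y ⟩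
      det (suc n) (setColumn (setColumn M b z) a x) + det (suc n) (setColumn (setColumn M b z) a y)
        ≡⟨ sym (cong₂ _+_ (swap-order x) (swap-order y)) ⟩
      D x z + D y z ∎
      where
      swap-order : ∀ w → D w z ≡ det (suc n) (setColumn (setColumn M b z) a w)
      swap-order w = det-cong (suc n) (setColumn-comm M w z a≢b)

  det-equal-columns-apart : ∀ d n (M : Matrix (suc n)) {a b} → suc (toℕ a ℕ.+ d) ≡ toℕ b →
    (∀ i → M i a ≡ M i b) → det (suc n) M ≡ 0ℤ
  det-equal-columns-apart zero n M {a} {suc c} b≡1+a e =
    det-adjacent-equal-columns n M c (λ i → trans (cong (M i) (sym a≡c)) (e i))
    where
    a≡c : a ≡ inject₁ c
    a≡c = FinP.toℕ-injective (trans (sym (ℕP.+-identityʳ (toℕ a)))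
                                    (trans (ℕP.suc-injective b≡1+a) (sym (FinP.toℕ-inject₁ c))))
  det-equal-columns-apart (suc d) n M {a} {suc c} b≡1+a+d e = begin
    det (suc n) M
      ≡⟨ sym (ℤP.neg-involutive _) ⟩
    - - det (suc n) M
      ≡⟨ cong -_ (sym (det-swap-adjacent-columns n M c)) ⟩
    - det (suc n) N
      ≡⟨ cong -_ (det-equal-columns-apart d n N c≡1+a+d (λ i → trans (N-a i) (trans (e i) (sym (N-c i))))) ⟩
    0ℤ ∎
    where
    open ≡-Reasoning
    N : Matrix (suc n)
    N = swapColumns M (inject₁ c) (suc c)
    c≡1+a+d : suc (toℕ a ℕ.+ d) ≡ toℕ (inject₁ c)
    c≡1+a+d = trans (sym (ℕP.+-suc (toℕ a) d)) (trans (ℕP.suc-injective b≡1+a+d) (sym (FinP.toℕ-inject₁ c)))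
    a≢c : a ≢ inject₁ c
    a≢c a≡c = ℕP.m≢1+m+n (toℕ a) (trans (cong toℕ a≡c)
                (trans (FinP.toℕ-inject₁ c) (trans (sym (ℕP.suc-injective b≡1+a+d)) (ℕP.+-suc (toℕ a) d))))
    a≢b : a ≢ suc c
    a≢b a≡b = ℕP.m≢1+m+n (toℕ a) (trans (cong toℕ a≡b) (sym b≡1+a+d))
    M′ : Matrix (suc n)
    M′ = setColumn M (inject₁ c) (λ i → M i (suc c))
    N-a : ∀ i → N i a ≡ M i a
    N-a i = trans (setColumn-minimal M′ (λ i → M i (inject₁ c)) i a≢b) (setColumn-minimal M (λ i → M i (suc c)) i a≢c)
    N-c : ∀ i → N i (inject₁ c) ≡ M i (suc c)
    N-c i = trans (setColumn-minimal M′ (λ i → M i (inject₁ c)) i (inject₁≢suc c))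
                  (setColumn-updates M (inject₁ c) (λ i → M i (suc c)) i)

  det-equal-columns : ∀ n (M : Matrix n) {a b} → a ≢ b → (∀ i → M i a ≡ M i b) → det n M ≡ 0ℤ
  det-equal-columns (suc n) M {a} {b} a≢b e with ℕP.<-cmp (toℕ a) (toℕ b)
  ... | tri< a<b _ _ = let d , a+d≡b = ℕP.m≤n⇒∃[o]m+o≡n a<b in det-equal-columns-apart d n M a+d≡b e
  ... | tri≈ _ a≡b _ = ⊥-elim (a≢b (FinP.toℕ-injective a≡b))
  ... | tri> _ _ b<a = let d , b+d≡a = ℕP.m≤n⇒∃[o]m+o≡n b<a in det-equal-columns-apart d n M b+d≡a (sym ∘ e)

  det-column-operation : ∀ n (M : Matrix n) {k j} → k ≢ j → ∀ (u v : ℤ) →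
    det n (setColumn M k (λ i → u * M i k + v * M i j)) ≡ u * det n M
  det-column-operation n M {k} {j} k≢j u v = begin
    det n (setColumn M k (λ i → u * M i k + v * M i j))
      ≡⟨ det-linear n M k u v (λ i → M i k) (λ i → M i j) ⟩
    u * det n (setColumn M k (λ i → M i k)) + v * det n (setColumn M k (λ i → M i j))
      ≡⟨ cong₂ (λ x y → u * x + v * y) (det-cong n (setColumn-id M k)) (det-equal-columns n _ k≢j copied) ⟩
    u * det n M + v * 0ℤ
      ≡⟨ trans (cong (_+_ (u * det n M)) (ℤP.*-zeroʳ v)) (ℤP.+-identityʳ _) ⟩
    u * det n M ∎
    where
    open ≡-Reasoning
    copied : ∀ i → setColumn M k (λ i → M i j) i k ≡ setColumn M k (λ i → M i j) i j
    copied i = trans (setColumn-updates M k (λ i → M i j) i) (sym (setColumn-minimal M (λ i → M i j) i (k≢j ∘ sym)))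

module PrimeDivisors {p : ℕ} (p-prime : Prime p) where

  open import Data.Integer using (_*_; _^_)
  open import Data.Integer.Divisibility.Signed
  import Data.Nat.Divisibility as ℕD
  import Data.Sum as Sum

  euclid : ∀ a b → + p ∣ a * b → + p ∣ a ⊎ + p ∣ b
  euclid a b p∣ab = Sum.map ∣ᵤ⇒∣ ∣ᵤ⇒∣
    (euclidsLemma ℤ.∣ a ∣ ℤ.∣ b ∣ p-prime (subst (p ℕD.∣_) (ℤP.abs-* a b) (∣⇒∣ᵤ p∣ab)))

  ∤-* : ∀ {a b} → ¬ + p ∣ a → ¬ + p ∣ b → ¬ + p ∣ a * b
  ∤-* {a} {b} p∤a p∤b = [ p∤a , p∤b ]′ ∘ euclid a b

  ∤-1 : ¬ + p ∣ 1ℤ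
  ∤-1 p∣1 with ℕD.∣1⇒≡1 (∣⇒∣ᵤ p∣1)
  ... | refl = ¬prime[1] p-prime

  ∤-^ : ∀ {a} n → ¬ + p ∣ a → ¬ + p ∣ a ^ n
  ∤-^ zero    p∤a = ∤-1
  ∤-^ (suc n) p∤a = ∤-* p∤a (∤-^ n p∤a)

  ∤-sgn : ∀ k → ¬ + p ∣ sgn k
  ∤-sgn zero    = ∤-1
  ∤-sgn (suc k) p∣-s = ∤-sgn k (subst (+ p ∣_) (ℤP.neg-involutive (sgn k)) (∣m⇒∣-m p∣-s))

  ∤-cancelˡ : ∀ {a b} → ¬ + p ∣ a → + p ∣ a * b → + p ∣ b
  ∤-cancelˡ {a} {b} p∤a = [ ⊥-elim ∘ p∤a , id ]′ ∘ euclid a b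

  ∤-positive : ∀ {a} → 0 ℕ.< a → a ℕ.< p → ¬ + p ∣ + a
  ∤-positive {suc a} _ a<p p∣a = ℕP.<⇒≱ a<p (ℕD.∣⇒≤ (∣⇒∣ᵤ p∣a))

module Elimination {p : ℕ} (p-prime : Prime p) where

  open import Data.Integer using (_+_; _*_; -_)
  open import Data.Integer.Divisibility.Signed using (_∣_; _∣?_; ∣n⇒∣m*n)
  open import Data.Integer.Solver using (module +-*-Solver)
  open import Data.Fin.Properties using (all?; ¬∀⟶∃¬)
  open +-*-Solver
  open Congruence
  open Sums
  open Determinants
  open PrimeDivisors p-prime

  RowsIndependent : ∀ n → Matrix n → Set
  RowsIndependent n M =
    ∀ (l : Fin n → ℤ) → (∀ j → ∑ (λ i → l i * M i j) ≡ 0ℤ mod p) → ∀ i → l i ≡ 0ℤ mod p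

  independent⇒pivot : ∀ {n} {M : Matrix (suc n)} → RowsIndependent (suc n) M → ∃ λ j → ¬ + p ∣ M zero j
  independent⇒pivot {n} {M} independent with all? (λ j → + p ∣? M zero j)
  ... | no  ¬p∣row = ¬∀⟶∃¬ (suc n) _ (λ j → + p ∣? M zero j) ¬p∣row
  ... | yes p∣row  = ⊥-elim (∤-1 (≡0-mod⇒∣ (independent first-row first-row-combination zero)))
    where
    first-row : Fin (suc n) → ℤ
    first-row zero    = 1ℤ
    first-row (suc _) = 0ℤ
    other-rows-vanish : ∀ j i → i ≢ zero → first-row i * M i j ≡ 0ℤ
    other-rows-vanish j zero    0≢0 = ⊥-elim (0≢0 refl)
    other-rows-vanish j (suc i) _   = ℤP.*-zeroˡ (M (suc i) j)
    first-row-combination : ∀ j → ∑ (λ i → first-row i * M i j) ≡ 0ℤ mod p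
    first-row-combination j =
      ∣⇒≡0-mod (subst (+ p ∣_) (sym (∑-support₁ _ zero (other-rows-vanish j))) (∣n⇒∣m*n 1ℤ (p∣row j)))

  column-operation-independent : ∀ {n} (M : Matrix n) {k j} → k ≢ j → ∀ {u} v → ¬ + p ∣ u →
    RowsIndependent n M → RowsIndependent n (setColumn M k (λ i → u * M i k + v * M i j))
  column-operation-independent {n} M {k} {j} k≢j {u} v p∤u independent l N-combination = independent l M-combination
    where
    open ≡-mod-Reasoning p
    column : Fin n → Fin n → ℤ
    column j′ i = M i j′
    w : Fin n → ℤ
    w i = u * M i k + v * M i j
    off-k : ∀ {j′} → j′ ≢ k → ∑ (λ i → l i * M i j′) ≡ 0ℤ mod p
    off-k {j′} j′≢k = begin
      ∑ (λ i → l i * M i j′)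
        ≡⟨ ∑-cong (λ i → cong (l i *_) (sym (setColumn-minimal M w i j′≢k))) ⟩
      ∑ (λ i → l i * setColumn M k w i j′)
        ≈⟨ N-combination j′ ⟩
      0ℤ ∎
    M-combination : ∀ j′ → ∑ (λ i → l i * M i j′) ≡ 0ℤ mod p
    M-combination j′ with j′ Fin.≟ k
    ... | no j′≢k  = off-k j′≢k
    ... | yes refl = ∣⇒≡0-mod (∤-cancelˡ p∤u (≡0-mod⇒∣ (begin
      u * S
        ≡⟨ sym (trans (cong (_+_ (u * S)) (ℤP.*-zeroʳ v)) (ℤP.+-identityʳ (u * S))) ⟩
      u * S + v * 0ℤ
        ≈⟨ +-cong-mod (refl-mod {a = u * S}) (*-cong-mod (refl-mod {a = v}) (sym-mod (off-k (k≢j ∘ sym)))) ⟩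
      u * S + v * T
        ≡⟨ sym (∑-linear l (column k) (column j) u v) ⟩
      ∑ (λ i → l i * w i)
        ≡⟨ ∑-cong (λ i → cong (l i *_) (sym (setColumn-updates M k w i))) ⟩
      ∑ (λ i → l i * setColumn M k w i k)
        ≈⟨ N-combination k ⟩
      0ℤ ∎)))
      where
      S T : ℤ
      S = ∑ (λ i → l i * M i k)
      T = ∑ (λ i → l i * M i j)

  pivot-expansion : ∀ {n} (M : Matrix (suc n)) j → (∀ k → k ≢ j → M zero k ≡ 0ℤ) →
    det (suc n) M ≡ sgn (toℕ j) * M zero j * det n (minor M j)
  pivot-expansion {n} M j cleared = ∑-support₁ (laplaceTerm M) j λ k k≢j →
    trans (cong (λ a → sgn (toℕ k) * a * det n (minor M k)) (cleared k k≢j))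
          (trans (cong (_* det n (minor M k)) (ℤP.*-zeroʳ (sgn (toℕ k)))) (ℤP.*-zeroˡ (det n (minor M k))))

  pivot-minor-independent : ∀ {n} (M : Matrix (suc n)) j → (∀ k → k ≢ j → M zero k ≡ 0ℤ) → ¬ + p ∣ M zero j →
    RowsIndependent (suc n) M → RowsIndependent n (minor M j)
  pivot-minor-independent {n} M j cleared p∤a independent l minor-combination i =
    ∣⇒≡0-mod (∤-cancelˡ p∤a (≡0-mod⇒∣ (independent μ μ-combination (suc i))))
    where
    open ≡-mod-Reasoning p
    a : ℤ
    a = M zero j
    S : ℤ
    S = ∑ (λ i → l i * M (suc i) j)
    -- a combination of the rows of M that vanishes in column j and restricts to a · l on the minor
    μ : Fin (suc n) → ℤ
    μ zero    = - S
    μ (suc i) = a * l i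
    expand : ∀ j′ → ∑ (λ i → μ i * M i j′) ≡ - S * M zero j′ + a * ∑ (λ i → l i * M (suc i) j′)
    expand j′ = cong (_+_ (- S * M zero j′))
      (trans (∑-cong (λ i → ℤP.*-assoc a (l i) (M (suc i) j′))) (sym (*-distribˡ-∑ a (λ i → l i * M (suc i) j′))))
    μ-combination : ∀ j′ → ∑ (λ i → μ i * M i j′) ≡ 0ℤ mod p
    μ-combination j′ with j′ Fin.≟ j
    ... | yes refl = reflexive-mod (trans (expand j) (solve 2 (λ s a → (:- s) :* a :+ a :* s := con 0ℤ) refl S a))
    ... | no j′≢j = begin
      ∑ (λ i → μ i * M i j′)    ≡⟨ expand j′ ⟩
      - S * M zero j′ + a * X   ≡⟨ cong (λ z → - S * z + a * X) (cleared j′ j′≢j) ⟩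
      - S * 0ℤ + a * X          ≈⟨ +-cong-mod (refl-mod {a = - S * 0ℤ}) (*-cong-mod (refl-mod {a = a}) X≡0) ⟩
      - S * 0ℤ + a * 0ℤ         ≡⟨ solve 2 (λ s a → (:- s) :* con 0ℤ :+ a :* con 0ℤ := con 0ℤ) refl S a ⟩
      0ℤ ∎
      where
      X : ℤ
      X = ∑ (λ i → l i * M (suc i) j′)
      k : Fin n
      k = punchOut (j′≢j ∘ sym)
      X≡0 : X ≡ 0ℤ mod p
      X≡0 = subst (λ c → ∑ (λ i → l i * M (suc i) c) ≡ 0ℤ mod p)
                  (FinP.punchIn-punchOut (j′≢j ∘ sym)) (minor-combination k)

  -- With a = M₀ⱼ ≢ 0, the column operations col k ← a · col k − M₀ₖ · col j clear the first row outside
  -- the pivot one column at a time; each multiplies det by a and keeps the rows independent.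
  module Clearing {n} (minor-det≢0 : ∀ (N : Matrix n) → RowsIndependent n N → ¬ + p ∣ det n N)
                  (j : Fin (suc n)) where

    ClearedBelow : ℕ → Matrix (suc n) → Set
    ClearedBelow m M = ∀ k → toℕ k ℕ.< m → k ≢ j → M zero k ≡ 0ℤ

    extend : ∀ {m} M → ClearedBelow m M → (∀ k → toℕ k ≡ m → k ≢ j → M zero k ≡ 0ℤ) →
      ClearedBelow (suc m) M
    extend M old new k k<1+m with ℕP.m<1+n⇒m<n∨m≡n k<1+m
    ... | inj₁ k<m = old k k<m
    ... | inj₂ k≡m = new k k≡m

    pivot-det≢0 : ∀ M → (∀ k → k ≢ j → M zero k ≡ 0ℤ) → ¬ + p ∣ M zero j → RowsIndependent (suc n) M →
      ¬ + p ∣ det (suc n) M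
    pivot-det≢0 M cleared p∤a independent p∣det =
      [ ∤-* (∤-sgn (toℕ j)) p∤a , minor-det≢0 (minor M j) (pivot-minor-independent M j cleared p∤a independent) ]′
      (euclid (sgn (toℕ j) * M zero j) (det n (minor M j)) (subst (+ p ∣_) (pivot-expansion M j cleared) p∣det))

    clear : ∀ d m (M : Matrix (suc n)) → m ℕ.+ d ≡ suc n → RowsIndependent (suc n) M → ¬ + p ∣ M zero j →
      ClearedBelow m M → ¬ + p ∣ det (suc n) M
    clear zero m M m+0≡1+n independent p∤a cleared = pivot-det≢0 M all-cleared p∤a independent
      where
      all-cleared : ∀ k → k ≢ j → M zero k ≡ 0ℤ
      all-cleared k = cleared k (subst (toℕ k ℕ.<_) (trans (sym m+0≡1+n) (ℕP.+-identityʳ m)) (FinP.toℕ<n k))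
    clear (suc d) m M m+1+d≡1+n independent p∤a cleared =
      clear-column (Fin.fromℕ< m<1+n) (FinP.toℕ-fromℕ< m<1+n)
      where
      m<1+n : m ℕ.< suc n
      m<1+n = subst (m ℕ.<_) m+1+d≡1+n (ℕP.m<m+n m (s≤s z≤n))
      1+m+d≡1+n : suc m ℕ.+ d ≡ suc n
      1+m+d≡1+n = trans (sym (ℕP.+-suc m d)) m+1+d≡1+n
      a : ℤ
      a = M zero j
      clear-column : ∀ k → toℕ k ≡ m → ¬ + p ∣ det (suc n) M
      clear-column k k≡m with k Fin.≟ j
      ... | yes k≡j = clear d (suc m) M 1+m+d≡1+n independent p∤a
                        (extend M cleared λ k′ k′≡m k′≢j →
                           ⊥-elim (k′≢j (trans (FinP.toℕ-injective (trans k′≡m (sym k≡m))) k≡j)))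
      ... | no k≢j = λ p∣det → clear d (suc m) M′ 1+m+d≡1+n
                       (column-operation-independent M k≢j (- M zero k) p∤a independent)
                       (subst (λ c → ¬ + p ∣ c) (sym (setColumn-minimal M w zero (k≢j ∘ sym))) p∤a)
                       (extend M′ cleared-old cleared-new)
                       (subst (+ p ∣_) (sym (det-column-operation (suc n) M k≢j a (- M zero k))) (∣n⇒∣m*n a p∣det))
        where
        w : Fin (suc n) → ℤ
        w i = a * M i k + - M zero k * M i j
        M′ : Matrix (suc n)
        M′ = setColumn M k w
        cleared-old : ClearedBelow m M′
        cleared-old k′ k′<m k′≢j =
          trans (setColumn-minimal M w zero (λ k′≡k → ℕP.<-irrefl (trans (cong toℕ k′≡k) k≡m) k′<m))
                (cleared k′ k′<m k′≢j)
        cleared-new : ∀ k′ → toℕ k′ ≡ m → k′ ≢ j → M′ zero k′ ≡ 0ℤ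
        cleared-new k′ k′≡m _ with FinP.toℕ-injective (trans k′≡m (sym k≡m))
        ... | refl = trans (setColumn-updates M k w zero)
                           (solve 2 (λ a b → a :* b :+ (:- b) :* a := con 0ℤ) refl a (M zero k))

  independent⇒det≢0 : ∀ n (M : Matrix n) → RowsIndependent n M → ¬ + p ∣ det n M
  independent⇒det≢0 zero    M independent = ∤-1
  independent⇒det≢0 (suc n) M independent =
    let j , p∤a = independent⇒pivot {M = M} independent
    in Clearing.clear (independent⇒det≢0 n) j (suc n) 0 M refl independent p∤a (λ _ ())

module Binomials where

  open import Data.Nat using (_+_; _*_)
  open import Data.Nat.Combinatorics using (_C_; nC1≡n; nCk+nC[k+1]≡[n+1]C[k+1])
  open import Data.Nat.Divisibility using (_∣_; divides; ∣⇒≤)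
  open import Data.Nat.Solver using (module +-*-Solver)
  open +-*-Solver

  [1+k]*[1+n]C[1+k]≡[1+n]*nCk : ∀ n k → suc k * (suc n C suc k) ≡ suc n * (n C k)
  [1+k]*[1+n]C[1+k]≡[1+n]*nCk zero    zero    = refl
  [1+k]*[1+n]C[1+k]≡[1+n]*nCk zero    (suc k) = ℕP.*-zeroʳ (2 + k)
  [1+k]*[1+n]C[1+k]≡[1+n]*nCk (suc n) zero    =
    trans (ℕP.*-identityˡ _) (trans (nC1≡n (2 + n)) (sym (ℕP.*-identityʳ (2 + n))))
  [1+k]*[1+n]C[1+k]≡[1+n]*nCk (suc n) (suc k) = begin
    (2 + k) * ((2 + n) C (2 + k))
      ≡⟨ cong ((2 + k) *_) (sym (nCk+nC[k+1]≡[n+1]C[k+1] (suc n) (suc k))) ⟩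
    (2 + k) * (A + B)
      ≡⟨ solve 3 (λ k a b → (con 2 :+ k) :* (a :+ b) := (con 1 :+ k) :* a :+ a :+ (con 2 :+ k) :* b) refl k A B ⟩
    (1 + k) * A + A + (2 + k) * B
      ≡⟨ cong₂ (λ u v → u + A + v) ([1+k]*[1+n]C[1+k]≡[1+n]*nCk n k) ([1+k]*[1+n]C[1+k]≡[1+n]*nCk n (suc k)) ⟩
    (1 + n) * (n C k) + A + (1 + n) * (n C suc k)
      ≡⟨ solve 4 (λ n a c d → (con 1 :+ n) :* c :+ a :+ (con 1 :+ n) :* d := (con 1 :+ n) :* (c :+ d) :+ a)
                 refl n A (n C k) (n C suc k) ⟩
    (1 + n) * (n C k + n C suc k) + A
      ≡⟨ cong (λ u → (1 + n) * u + A) (nCk+nC[k+1]≡[n+1]C[k+1] n k) ⟩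
    (1 + n) * A + A
      ≡⟨ solve 2 (λ n a → (con 1 :+ n) :* a :+ a := (con 2 :+ n) :* a) refl n A ⟩
    (2 + n) * A ∎
    where
    open ≡-Reasoning
    A B : ℕ
    A = suc n C suc k
    B = suc n C suc (suc k)

  prime∣pCk : ∀ {p k} → Prime p → 0 ℕ.< k → k ℕ.< p → p ∣ p C k
  prime∣pCk {suc n} {suc k} p-prime _ k<p
    with euclidsLemma (suc k) (suc n C suc k) p-prime
           (divides (n C k) (trans ([1+k]*[1+n]C[1+k]≡[1+n]*nCk n k) (ℕP.*-comm (suc n) (n C k))))
  ... | inj₁ p∣1+k = ⊥-elim (ℕP.<⇒≱ k<p (∣⇒≤ p∣1+k))
  ... | inj₂ p∣C   = p∣C

module Fermat {t : ℕ} (p-prime : Prime (suc t)) where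

  open import Data.Integer using (_+_; _*_; _-_; _^_)
  open import Data.Integer.Divisibility.Signed using (_∣_; ∣ᵤ⇒∣; ∣m⇒∣m*n)
  open import Data.Integer.Solver using (module +-*-Solver)
  open +-*-Solver
  open import Data.Nat.Combinatorics using (_C_; nCn≡1)
  open import Algebra.Bundles using (CommutativeSemiring)
  import Algebra.Properties.Semiring.Mult (CommutativeSemiring.semiring ℤP.+-*-commutativeSemiring) as Mult
  import Algebra.Properties.Semiring.Exp (CommutativeSemiring.semiring ℤP.+-*-commutativeSemiring) as Exp
  import Algebra.Properties.CommutativeSemiring.Binomial ℤP.+-*-commutativeSemiring as Binomial
  import Algebra.Properties.Semiring.Sum (CommutativeSemiring.semiring ℤP.+-*-commutativeSemiring) as Sum
  open Congruence
  open Sums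
  open Binomials
  open PrimeDivisors p-prime

  private
    p : ℕ
    p = suc t

  ×≡* : ∀ n x → n Mult.× x ≡ + n * x
  ×≡* zero    x = sym (ℤP.*-zeroˡ x)
  ×≡* (suc n) x = trans (cong (_+_ x) (×≡* n x)) (sym (ℤP.suc-* (+ n) x))

  ^≡^ : ∀ x n → x Exp.^ n ≡ x ^ n
  ^≡^ x zero    = refl
  ^≡^ x (suc n) = cong (x *_) (^≡^ x n)

  ∑≡sum : ∀ {n} (f : Fin n → ℤ) → ∑ f ≡ Sum.sum f
  ∑≡sum {zero}  f = refl
  ∑≡sum {suc n} f = cong (_+_ (f zero)) (∑≡sum (λ i → f (suc i)))

  private
    term : ℤ → Fin (suc p) → ℤ
    term x = Binomial.binomialTerm 1ℤ x p

    first-term : ∀ x → term x zero ≡ x ^ p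
    first-term x = trans (×≡* 1 (1ℤ * x Exp.^ p)) (trans (ℤP.*-identityˡ _) (trans (ℤP.*-identityˡ _) (^≡^ x p)))

    middle-term : ∀ x (k : Fin p) → k ≢ Fin.fromℕ t → term x (suc k) ≡ 0ℤ mod p
    middle-term x k k≢t = subst (_≡ 0ℤ mod p) (sym (×≡* (p C suc (toℕ k)) b))
      (∣⇒≡0-mod (∣m⇒∣m*n b (∣ᵤ⇒∣ {+ p} {+ (p C suc (toℕ k))} (prime∣pCk p-prime (s≤s z≤n) (s≤s k<t)))))
      where
      b : ℤ
      b = Binomial.binomial 1ℤ x p (suc k)
      k<t : toℕ k ℕ.< t
      k<t = ℕP.≤∧≢⇒< (ℕP.m<1+n⇒m≤n (FinP.toℕ<n k))
                     (λ k≡t → k≢t (FinP.toℕ-injective (trans k≡t (sym (FinP.toℕ-fromℕ t)))))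

    last-term : ∀ x → term x (suc (Fin.fromℕ t)) ≡ 1ℤ
    last-term x rewrite FinP.toℕ-fromℕ t = begin
      (p C p) Mult.× (1ℤ Exp.^ p * x Exp.^ (t ℕ.∸ t))
        ≡⟨ ×≡* (p C p) _ ⟩
      + (p C p) * (1ℤ Exp.^ p * x Exp.^ (t ℕ.∸ t))
        ≡⟨ cong₂ (λ c e → + c * (1ℤ Exp.^ p * x Exp.^ e)) (nCn≡1 p) (ℕP.n∸n≡0 t) ⟩
      1ℤ * (1ℤ Exp.^ p * 1ℤ)
        ≡⟨ trans (ℤP.*-identityˡ _) (trans (ℤP.*-identityʳ _) (trans (^≡^ 1ℤ p) (ℤP.^-zeroˡ p))) ⟩
      1ℤ                                               ∎
      where open ≡-Reasoning

  freshmans-dream : ∀ x → (1ℤ + x) ^ p ≡ 1ℤ + x ^ p mod p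
  freshmans-dream x = begin
    (1ℤ + x) ^ p
      ≡⟨ sym (^≡^ (1ℤ + x) p) ⟩
    (1ℤ + x) Exp.^ p
      ≡⟨ Binomial.theorem p 1ℤ x ⟩
    Sum.sum (term x)
      ≡⟨ sym (∑≡sum (term x)) ⟩
    term x zero + ∑ (λ k → term x (suc k))
      ≈⟨ +-cong-mod (reflexive-mod (first-term x)) (∑-support₁-mod _ (Fin.fromℕ t) (middle-term x)) ⟩
    x ^ p + term x (suc (Fin.fromℕ t))
      ≡⟨ cong (_+_ (x ^ p)) (last-term x) ⟩
    x ^ p + 1ℤ
      ≡⟨ ℤP.+-comm (x ^ p) 1ℤ ⟩
    1ℤ + x ^ p                            ∎
    where open ≡-mod-Reasoning p

  fermat : ∀ x → (+ x) ^ p ≡ + x mod p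
  fermat zero    = reflexive-mod (ℤP.*-zeroˡ (0ℤ ^ t))
  fermat (suc x) = begin
    (1ℤ + + x) ^ p   ≈⟨ freshmans-dream (+ x) ⟩
    1ℤ + (+ x) ^ p   ≈⟨ +-cong-mod (refl-mod {a = 1ℤ}) (fermat x) ⟩
    1ℤ + + x         ∎
    where open ≡-mod-Reasoning p

  fermat-little : ∀ {x} → ¬ + p ∣ + x → (+ x) ^ t ≡ 1ℤ mod p
  fermat-little {x} p∤x = ∣⇒≡mod (∤-cancelˡ p∤x (subst (+ p ∣_) factor (≡mod⇒∣ (fermat x))))
    where
    factor : + x * (+ x) ^ t - + x ≡ + x * ((+ x) ^ t - 1ℤ)
    factor = solve 2 (λ x y → x :* y :- x := x :* (y :- con 1ℤ)) refl (+ x) ((+ x) ^ t)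

module IntegerPowers where

  open import Data.Integer using (_*_; _^_)
  open import Data.Integer.Solver using (module +-*-Solver)
  open +-*-Solver

  pos-^ : ∀ m n → + (m ℕ.^ n) ≡ (+ m) ^ n
  pos-^ m zero    = refl
  pos-^ m (suc n) = trans (ℤP.pos-* m (m ℕ.^ n)) (cong (+ m *_) (pos-^ m n))

  ^-distribʳ-* : ∀ a b n → (a * b) ^ n ≡ a ^ n * b ^ n
  ^-distribʳ-* a b zero    = refl
  ^-distribʳ-* a b (suc n) =
    trans (cong ((a * b) *_) (^-distribʳ-* a b n))
          (solve 4 (λ a b x y → (a :* b) :* (x :* y) := (a :* x) :* (b :* y)) refl a b (a ^ n) (b ^ n))

module Orthogonality {n : ℕ} (p-prime : Prime (2 ℕ.+ n)) where

  open import Data.Integer using (_+_; _*_; -_; _-_; _^_)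
  open import Data.Integer.Divisibility.Signed using (_∣_; ∣-refl)
  open import Data.Integer.Solver using (module +-*-Solver)
  open +-*-Solver
  open Congruence
  open Sums
  open IntegerPowers
  open PrimeDivisors p-prime
  open Fermat p-prime

  private
    p t : ℕ
    p = 2 ℕ.+ n
    t = suc n

  powerSum : ℤ → ℤ
  powerSum u = ∑ {t} (λ a → u ^ toℕ a)

  powerSum-≡1 : ∀ {u} → u ≡ 1ℤ mod p → powerSum u ≡ - 1ℤ mod p
  powerSum-≡1 {u} u≡1 = begin
    ∑ {t} (λ a → u ^ toℕ a)   ≈⟨ ∑-cong-mod {n = t} (λ a → ^-cong-mod (toℕ a) u≡1) ⟩
    ∑ {t} (λ a → 1ℤ ^ toℕ a)  ≡⟨ ∑-cong {t} (λ a → ℤP.^-zeroˡ (toℕ a)) ⟩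
    ∑ {t} (λ _ → 1ℤ)          ≡⟨ trans (∑-const t 1ℤ) (ℤP.*-identityʳ (+ t)) ⟩
    + t                       ≈⟨ ∣⇒≡mod (subst (+ p ∣_) (cong +_ (ℕP.+-comm 1 t)) ∣-refl) ⟩
    - 1ℤ                      ∎
    where open ≡-mod-Reasoning p

  powerSum-≢1 : ∀ {u} → u ^ t ≡ 1ℤ mod p → ¬ u ≡ 1ℤ mod p → powerSum u ≡ 0ℤ mod p
  powerSum-≢1 {u} u^t≡1 u≢1 =
    ∣⇒≡0-mod (∤-cancelˡ (u≢1 ∘ ∣⇒≡mod) (subst (+ p ∣_) (sym (geometric-sum u t)) (≡mod⇒∣ u^t≡1)))

  -- an inverse of x₀ modulo p, by Fermat's little theorem
  inverse : ℕ → ℕ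
  inverse x₀ = x₀ ℕ.^ n

  inverse-* : ∀ {x₀} → ¬ + p ∣ + x₀ → + inverse x₀ * + x₀ ≡ 1ℤ mod p
  inverse-* {x₀} p∤x₀ =
    trans-mod (reflexive-mod (trans (cong (_* + x₀) (pos-^ x₀ n)) (ℤP.*-comm ((+ x₀) ^ n) (+ x₀))))
              (fermat-little p∤x₀)

  powerSum-same-residue : ∀ {x₀ x} → ¬ + p ∣ + x₀ → + x ≡ + x₀ mod p →
    powerSum (+ inverse x₀ * + x) ≡ - 1ℤ mod p
  powerSum-same-residue {x₀} p∤x₀ x≡x₀ =
    powerSum-≡1 (trans-mod (*-cong-mod (refl-mod {a = + inverse x₀}) x≡x₀) (inverse-* p∤x₀))

  powerSum-other-residue : ∀ {x₀ x} → ¬ + p ∣ + x₀ → ¬ + p ∣ + x → ¬ + x ≡ + x₀ mod p →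
    powerSum (+ inverse x₀ * + x) ≡ 0ℤ mod p
  powerSum-other-residue {x₀} {x} p∤x₀ p∤x x≢x₀ = powerSum-≢1 u^t≡1 u≢1
    where
    open ≡-mod-Reasoning p
    w : ℤ
    w = + inverse x₀
    p∤w : ¬ + p ∣ w
    p∤w = subst (λ z → ¬ + p ∣ z) (sym (pos-^ x₀ n)) (∤-^ n p∤x₀)
    u^t≡1 : (w * + x) ^ t ≡ 1ℤ mod p
    u^t≡1 = begin
      (w * + x) ^ t      ≡⟨ ^-distribʳ-* w (+ x) t ⟩
      w ^ t * (+ x) ^ t  ≈⟨ *-cong-mod (fermat-little p∤w) (fermat-little p∤x) ⟩
      1ℤ * 1ℤ            ≡⟨⟩
      1ℤ                 ∎
    u≢1 : ¬ w * + x ≡ 1ℤ mod p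
    u≢1 u≡1 = x≢x₀ (begin
      + x                 ≡⟨ sym (ℤP.*-identityˡ (+ x)) ⟩
      1ℤ * + x            ≈⟨ *-cong-mod (sym-mod (inverse-* p∤x₀)) (refl-mod {a = + x}) ⟩
      w * + x₀ * + x      ≡⟨ solve 3 (λ w a b → w :* a :* b := a :* (w :* b)) refl w (+ x₀) (+ x) ⟩
      + x₀ * (w * + x)    ≈⟨ *-cong-mod (refl-mod {a = + x₀}) u≡1 ⟩
      + x₀ * 1ℤ           ≡⟨ ℤP.*-identityʳ (+ x₀) ⟩
      + x₀                ∎)

  -- ∑ₐ wᵃ ∑ᵢ cᵢ xᵢᵃ = ∑ᵢ cᵢ ∑ₐ (w xᵢ)ᵃ with w = x₀⁻¹ picks out the residue class of x₀ = x i₀.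
  residue-class-sum : ∀ {m} (x : Fin m → ℕ) → (∀ i → ¬ + p ∣ + x i) → ∀ {i₀ i₁} → i₀ ≢ i₁ →
    + x i₁ ≡ + x i₀ mod p → (∀ i → + x i ≡ + x i₀ mod p → i ≡ i₀ ⊎ i ≡ i₁) →
    ∀ (c : Fin m → ℤ) → (∀ (a : Fin t) → ∑ (λ i → c i * (+ x i) ^ toℕ a) ≡ 0ℤ mod p) →
    c i₀ + c i₁ ≡ 0ℤ mod p
  residue-class-sum {m} x p∤x {i₀} {i₁} i₀≢i₁ x₁≡x₀ class c orthogonal = begin
    c i₀ + c i₁
      ≡⟨ solve 2 (λ a b → a :+ b := :- (a :* :- con 1ℤ :+ b :* :- con 1ℤ)) refl (c i₀) (c i₁) ⟩
    - (c i₀ * - 1ℤ + c i₁ * - 1ℤ)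
      ≈⟨ neg-cong-mod (sym-mod filter) ⟩
    - ∑ (λ i → c i * powerSum (w * + x i))
      ≈⟨ neg-cong-mod rearrange ⟩
    - ∑ {t} (λ a → w ^ toℕ a * ∑ (λ i → c i * (+ x i) ^ toℕ a))
      ≈⟨ neg-cong-mod vanish ⟩
    - 0ℤ
      ≡⟨⟩
    0ℤ ∎
    where
    open ≡-mod-Reasoning p
    w : ℤ
    w = + inverse (x i₀)
    filter : ∑ (λ i → c i * powerSum (w * + x i)) ≡ c i₀ * - 1ℤ + c i₁ * - 1ℤ mod p
    filter = trans-mod (∑-support₂-mod _ i₀≢i₁ others)
               (+-cong-mod (*-cong-mod (refl-mod {a = c i₀}) (powerSum-same-residue (p∤x i₀) refl-mod))
                           (*-cong-mod (refl-mod {a = c i₁}) (powerSum-same-residue (p∤x i₀) x₁≡x₀)))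
      where
      others : ∀ i → i ≢ i₀ → i ≢ i₁ → c i * powerSum (w * + x i) ≡ 0ℤ mod p
      others i i≢i₀ i≢i₁ = trans-mod (*-cong-mod (refl-mod {a = c i}) (powerSum-other-residue (p∤x i₀) (p∤x i) x≢x₀))
                                     (reflexive-mod (ℤP.*-zeroʳ (c i)))
        where
        x≢x₀ : ¬ + x i ≡ + x i₀ mod p
        x≢x₀ x≡x₀ with class i x≡x₀
        ... | inj₁ i≡i₀ = i≢i₀ i≡i₀
        ... | inj₂ i≡i₁ = i≢i₁ i≡i₁
    rearrange :
      ∑ (λ i → c i * powerSum (w * + x i)) ≡ ∑ {t} (λ a → w ^ toℕ a * ∑ (λ i → c i * (+ x i) ^ toℕ a)) mod p
    rearrange = begin
      ∑ (λ i → c i * ∑ {t} (λ a → (w * + x i) ^ toℕ a))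
        ≡⟨ ∑-cong (λ i → *-distribˡ-∑ {t} (c i) (λ a → (w * + x i) ^ toℕ a)) ⟩
      ∑ (λ i → ∑ {t} (λ a → c i * (w * + x i) ^ toℕ a))
        ≡⟨ ∑-comm {m} {t} (λ i a → c i * (w * + x i) ^ toℕ a) ⟩
      ∑ {t} (λ a → ∑ (λ i → c i * (w * + x i) ^ toℕ a))
        ≡⟨ ∑-cong {t} (λ a → ∑-cong (λ i → separate a i)) ⟩
      ∑ {t} (λ a → ∑ (λ i → w ^ toℕ a * (c i * (+ x i) ^ toℕ a)))
        ≡⟨ ∑-cong {t} (λ a → sym (*-distribˡ-∑ (w ^ toℕ a) (λ i → c i * (+ x i) ^ toℕ a))) ⟩
      ∑ {t} (λ a → w ^ toℕ a * ∑ (λ i → c i * (+ x i) ^ toℕ a)) ∎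
      where
      separate : ∀ (a : Fin t) i → c i * (w * + x i) ^ toℕ a ≡ w ^ toℕ a * (c i * (+ x i) ^ toℕ a)
      separate a i =
        trans (cong (c i *_) (^-distribʳ-* w (+ x i) (toℕ a)))
              (solve 3 (λ c u v → c :* (u :* v) := u :* (c :* v)) refl (c i) (w ^ toℕ a) ((+ x i) ^ toℕ a))
    vanish : ∑ {t} (λ a → w ^ toℕ a * ∑ (λ i → c i * (+ x i) ^ toℕ a)) ≡ 0ℤ mod p
    vanish = trans-mod (∑-cong-mod {n = t} (λ a → *-cong-mod (refl-mod {a = w ^ toℕ a}) (orthogonal a)))
                       (reflexive-mod (∑-zero {t} _ (λ a → ℤP.*-zeroʳ (w ^ toℕ a))))

module FermatQuotient {n : ℕ} (p-prime : Prime (2 ℕ.+ n)) where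

  open import Data.Integer using (_+_; _*_; -_; _-_; _^_)
  open import Data.Integer.Divisibility.Signed using (_∣_; divides; ∣⇒∣ᵤ; ∣ᵤ⇒∣; ∣n⇒∣m*n; ∣-refl)
  open import Data.Integer.Solver using (module +-*-Solver)
  open import Data.Nat.DivMod using (_/_; _%_; m≡m%n+[m/n]*n; m*[n/m]≡n)
  import Data.Nat.Divisibility as ℕD
  open +-*-Solver
  open Congruence
  open IntegerPowers
  open PrimeDivisors p-prime
  open Fermat p-prime

  private
    p t : ℕ
    p = 2 ℕ.+ n
    t = suc n

  lift-power : ∀ m r s k → (r + s * + m) ^ suc k ≡ r ^ suc k + + suc k * (s * + m) * r ^ k mod (m ℕ.* m)
  lift-power m r s zero = reflexive-mod
    (solve 3 (λ r s m → (r :+ s :* m) :* con 1ℤ := r :* con 1ℤ :+ con 1ℤ :* (s :* m) :* con 1ℤ) refl r s (+ m))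
  lift-power m r s (suc k) = begin
    (r + s * + m) * (r + s * + m) ^ suc k
      ≈⟨ *-cong-mod (refl-mod {a = r + s * + m}) (lift-power m r s k) ⟩
    (r + s * + m) * (r ^ suc k + + suc k * (s * + m) * r ^ k)
      ≡⟨ solve 5 (λ r s m K R → (r :+ s :* m) :* (r :* R :+ K :* (s :* m) :* R)
                            := r :* (r :* R) :+ (con 1ℤ :+ K) :* (s :* m) :* (r :* R) :+ K :* s :* s :* R :* (m :* m))
                 refl r s (+ m) (+ suc k) (r ^ k) ⟩
    A + Z * (+ m * + m)
      ≈⟨ +-cong-mod (refl-mod {a = A}) (subst (λ m² → Z * m² ≡ 0ℤ mod (m ℕ.* m)) (ℤP.pos-* m m) (multiple≡0-mod Z)) ⟩
    A + 0ℤ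
      ≡⟨ ℤP.+-identityʳ A ⟩
    A ∎
    where
    open ≡-mod-Reasoning (m ℕ.* m)
    A Z : ℤ
    A = r ^ suc (suc k) + + suc (suc k) * (s * + m) * r ^ suc k
    Z = + suc k * s * s * r ^ k

  e₂-unfold : ∀ {x} → ¬ + p ∣ + x → e₂ p x ≡ ((x ℕ.^ t ℕ.∸ 1) / p) % p
  e₂-unfold {x} p∤x with x % p in x%p
  ... | zero  = ⊥-elim (p∤x (∣ᵤ⇒∣ (ℕD.m%n≡0⇒n∣m x p x%p)))
  ... | suc _ = refl

  e₂-spec : ∀ {x} → ¬ + p ∣ + x → (+ x) ^ t ≡ 1ℤ + + p * + e₂ p x mod (p ℕ.* p)
  e₂-spec {zero}     p∤x = ⊥-elim (p∤x (divides 0ℤ refl))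
  e₂-spec {x@(suc _)} p∤x = ∣⇒≡mod (divides (+ (q / p)) (begin
    (+ x) ^ t - (1ℤ + + p * + e₂ p x)
      ≡⟨ cong₂ (λ a e → a - (1ℤ + + p * + e)) (sym (pos-^ x t)) (e₂-unfold p∤x) ⟩
    + N - (1ℤ + + p * + (q % p))
      ≡⟨ cong (λ z → + z - (1ℤ + + p * + (q % p))) N≡ ⟩
    + (1 ℕ.+ p ℕ.* (q % p ℕ.+ q / p ℕ.* p)) - (1ℤ + + p * + (q % p))
      ≡⟨ cong (_- (1ℤ + + p * + (q % p))) (ℕ→ℤ (q % p) (q / p)) ⟩
    1ℤ + + p * (+ (q % p) + + (q / p) * + p) - (1ℤ + + p * + (q % p))
      ≡⟨ solve 3 (λ P e Q → con 1ℤ :+ P :* (e :+ Q :* P) :- (con 1ℤ :+ P :* e) := Q :* (P :* P))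
                 refl (+ p) (+ (q % p)) (+ (q / p)) ⟩
    + (q / p) * (+ p * + p)
      ≡⟨ cong (+ (q / p) *_) (sym (ℤP.pos-* p p)) ⟩
    + (q / p) * + (p ℕ.* p) ∎))
    where
    open ≡-Reasoning
    N q : ℕ
    N = x ℕ.^ t
    q = (N ℕ.∸ 1) / p
    1≤N : 1 ℕ.≤ N
    1≤N = ℕP.m^n>0 x t
    p∣N∸1 : p ℕD.∣ N ℕ.∸ 1
    p∣N∸1 = ∣⇒∣ᵤ (subst (+ p ∣_) (trans (cong (_- 1ℤ) (sym (pos-^ x t))) (trans (ℤP.m-n≡m⊖n N 1) (ℤP.⊖-≥ 1≤N)))
                       (≡mod⇒∣ (fermat-little p∤x)))
    N≡ : N ≡ 1 ℕ.+ p ℕ.* (q % p ℕ.+ q / p ℕ.* p)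
    N≡ = begin
      N                                   ≡⟨ sym (ℕP.m∸n+n≡m 1≤N) ⟩
      N ℕ.∸ 1 ℕ.+ 1                       ≡⟨ ℕP.+-comm (N ℕ.∸ 1) 1 ⟩
      1 ℕ.+ (N ℕ.∸ 1)                     ≡⟨ cong (1 ℕ.+_) (sym (m*[n/m]≡n p∣N∸1)) ⟩
      1 ℕ.+ p ℕ.* q                       ≡⟨ cong (λ z → 1 ℕ.+ p ℕ.* z) (m≡m%n+[m/n]*n q p) ⟩
      1 ℕ.+ p ℕ.* (q % p ℕ.+ q / p ℕ.* p) ∎
    ℕ→ℤ : ∀ e Q → + (1 ℕ.+ p ℕ.* (e ℕ.+ Q ℕ.* p)) ≡ 1ℤ + + p * (+ e + + Q * + p)
    ℕ→ℤ e Q = begin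
      + (1 ℕ.+ p ℕ.* (e ℕ.+ Q ℕ.* p))
        ≡⟨ cong (_+_ 1ℤ) (ℤP.pos-* p (e ℕ.+ Q ℕ.* p)) ⟩
      1ℤ + + p * + (e ℕ.+ Q ℕ.* p)
        ≡⟨ cong (λ z → 1ℤ + + p * z) (trans (ℤP.pos-+ e (Q ℕ.* p)) (cong (_+_ (+ e)) (ℤP.pos-* Q p))) ⟩
      1ℤ + + p * (+ e + + Q * + p) ∎

  e₂-lift : ∀ {r} k → ¬ + p ∣ + r →
    + p * + e₂ p (r ℕ.+ k ℕ.* p) ≡ (+ r) ^ t - 1ℤ + + p * (+ t * + k * (+ r) ^ n) mod (p ℕ.* p)
  e₂-lift {r} k p∤r = begin
    + p * + e₂ p x
      ≡⟨ solve 2 (λ P e → P :* e := (con 1ℤ :+ P :* e) :- con 1ℤ) refl (+ p) (+ e₂ p x) ⟩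
    1ℤ + + p * + e₂ p x - 1ℤ
      ≈⟨ +-cong-mod (sym-mod (e₂-spec p∤x)) (refl-mod {a = - 1ℤ}) ⟩
    (+ x) ^ t - 1ℤ
      ≡⟨ cong (λ z → z ^ t - 1ℤ) +x≡ ⟩
    (+ r + + k * + p) ^ t - 1ℤ
      ≈⟨ +-cong-mod (lift-power p (+ r) (+ k) n) (refl-mod {a = - 1ℤ}) ⟩
    (+ r) ^ t + + t * (+ k * + p) * (+ r) ^ n - 1ℤ
      ≡⟨ solve 5 (λ A B T K P → A :+ T :* (K :* P) :* B :- con 1ℤ := A :- con 1ℤ :+ P :* (T :* K :* B))
                 refl ((+ r) ^ t) ((+ r) ^ n) (+ t) (+ k) (+ p) ⟩
    (+ r) ^ t - 1ℤ + + p * (+ t * + k * (+ r) ^ n) ∎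
    where
    open ≡-mod-Reasoning (p ℕ.* p)
    x : ℕ
    x = r ℕ.+ k ℕ.* p
    +x≡ : + x ≡ + r + + k * + p
    +x≡ = trans (ℤP.pos-+ r (k ℕ.* p)) (cong (_+_ (+ r)) (ℤP.pos-* k p))
    p∤x : ¬ + p ∣ + x
    p∤x p∣x = p∤r (∣-resp-mod (∣⇒≡mod (subst (+ p ∣_) (sym x-r) (∣n⇒∣m*n (+ k) ∣-refl))) p∣x)
      where
      x-r : + x - + r ≡ + k * + p
      x-r = trans (cong (_- + r) +x≡) (solve 3 (λ r k p → r :+ k :* p :- r := k :* p) refl (+ r) (+ k) (+ p))

  -- By e₂-lift, e₂ (r + k p) − e₂ (r + k′ p) ≡ t (k − k′) rⁿ (mod p).
  e₂-lifts-distinct : ∀ {r k k′} → ¬ + p ∣ + r → k ℕ.< p → k′ ℕ.< p →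
    + e₂ p (r ℕ.+ k ℕ.* p) ≡ + e₂ p (r ℕ.+ k′ ℕ.* p) mod p → k ≡ k′
  e₂-lifts-distinct {r} {k} {k′} p∤r k<p k′<p e≡e′ = ≡mod⇒≡-below k<p k′<p (∣⇒≡mod p∣k-k′)
    where
    e e′ D : ℤ
    e  = + e₂ p (r ℕ.+ k ℕ.* p)
    e′ = + e₂ p (r ℕ.+ k′ ℕ.* p)
    D  = + t * (+ r) ^ n * (+ k - + k′)
    p*e-e′≡p*D : + p * (e - e′) ≡ + p * D mod (p ℕ.* p)
    p*e-e′≡p*D = begin
      + p * (e - e′)
        ≡⟨ solve 3 (λ P e e′ → P :* (e :- e′) := P :* e :- P :* e′) refl (+ p) e e′ ⟩
      + p * e - + p * e′
        ≈⟨ +-cong-mod (e₂-lift k p∤r) (neg-cong-mod (e₂-lift k′ p∤r)) ⟩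
      (+ r) ^ t - 1ℤ + + p * (+ t * + k * (+ r) ^ n) - ((+ r) ^ t - 1ℤ + + p * (+ t * + k′ * (+ r) ^ n))
        ≡⟨ solve 6 (λ A B T K K′ P → A :- con 1ℤ :+ P :* (T :* K :* B) :- (A :- con 1ℤ :+ P :* (T :* K′ :* B))
                                  := P :* (T :* B :* (K :- K′)))
                   refl ((+ r) ^ t) ((+ r) ^ n) (+ t) (+ k) (+ k′) (+ p) ⟩
      + p * D                      ∎
      where open ≡-mod-Reasoning (p ℕ.* p)
    p∣D : + p ∣ D
    p∣D = ≡0-mod⇒∣ (trans-mod (sym-mod (*-cancelˡ-mod {p} {p} p*e-e′≡p*D)) (∣⇒≡0-mod (≡mod⇒∣ e≡e′)))
    p∣k-k′ : + p ∣ + k - + k′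
    p∣k-k′ = ∤-cancelˡ (∤-* (∤-positive (s≤s z≤n) ℕP.≤-refl) (∤-^ n p∤r)) p∣D

module IncreasingVectors where

  open import Data.Nat using (_+_; _∸_; _<_; _≤_)
  open import Data.Vec using (Vec; []; _∷_; lookup)

  increasing-tail : ∀ {n x} {v : Vec ℕ n} → Increasing (x ∷ v) → Increasing v
  increasing-tail increasing i j i<j = increasing (suc i) (suc j) (s≤s i<j)

  increasing-lower : ∀ {n} L (v : Vec ℕ n) → Increasing v → (∀ i → L ≤ lookup v i) →
    ∀ i → L + toℕ i ≤ lookup v i
  increasing-lower L (x ∷ v) increasing L≤ zero    = subst (_≤ x) (sym (ℕP.+-identityʳ L)) (L≤ zero)
  increasing-lower L (x ∷ v) increasing L≤ (suc i) =
    subst (_≤ lookup v i) (sym (ℕP.+-suc L (toℕ i)))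
          (increasing-lower (suc L) v (increasing-tail increasing)
                            (λ j → ℕP.≤-<-trans (L≤ zero) (increasing zero (suc j) (s≤s z≤n))) i)

  increasing-upper : ∀ {n} U (v : Vec ℕ n) → Increasing v → (∀ i → lookup v i < U) →
    ∀ i → lookup v i + (n ∸ toℕ i) ≤ U
  increasing-upper U (x ∷ [])    increasing <U zero    = subst (_≤ U) (ℕP.+-comm 1 x) (<U zero)
  increasing-upper {suc (suc m)} U (x ∷ y ∷ v) increasing <U zero = begin
    x + suc (suc m)  ≡⟨ ℕP.+-suc x (suc m) ⟩
    suc x + suc m    ≤⟨ ℕP.+-monoˡ-≤ (suc m) (increasing zero (suc zero) (s≤s z≤n)) ⟩
    y + suc m        ≤⟨ increasing-upper U (y ∷ v) (increasing-tail increasing) (<U ∘ suc) zero ⟩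
    U                ∎
    where open ℕP.≤-Reasoning
  increasing-upper U (x ∷ v)     increasing <U (suc i) = increasing-upper U v (increasing-tail increasing) (<U ∘ suc) i

  increasing-bounded⇒identity : ∀ {n} (v : Vec ℕ n) → Increasing v → (∀ i → lookup v i < n) →
    ∀ i → lookup v i ≡ toℕ i
  increasing-bounded⇒identity {n} v increasing <n i = ℕP.≤-antisym upper (increasing-lower 0 v increasing (λ _ → z≤n) i)
    where
    upper : lookup v i ≤ toℕ i
    upper = ℕP.+-cancelʳ-≤ (n ∸ toℕ i) (lookup v i) (toℕ i)
      (subst (lookup v i + (n ∸ toℕ i) ≤_)
             (trans (sym (ℕP.m∸n+n≡m (ℕP.<⇒≤ (FinP.toℕ<n i)))) (ℕP.+-comm (n ∸ toℕ i) (toℕ i)))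
             (increasing-upper n v increasing <n i))

  increasing⇒injective : ∀ {n} (v : Vec ℕ n) → Increasing v → ∀ {i j} → lookup v i ≡ lookup v j → i ≡ j
  increasing⇒injective v increasing {i} {j} vi≡vj with FinP.<-cmp i j
  ... | tri< i<j _ _ = ⊥-elim (ℕP.<-irrefl vi≡vj (increasing i j i<j))
  ... | tri≈ _ i≡j _ = i≡j
  ... | tri> _ _ j<i = ⊥-elim (ℕP.<-irrefl (sym vi≡vj) (increasing j i j<i))

module GoodMatrices {n : ℕ} (p-prime : Prime (2 ℕ.+ n)) where

  open import Data.Integer using (_+_; _*_; _-_; _^_)
  open import Data.Integer.Divisibility.Signed using (_∣_)
  open import Data.Integer.Solver using (module +-*-Solver)
  open import Data.Vec using (Vec; lookup)
  open +-*-Solver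
  open Congruence
  open Sums
  open IntegerPowers
  open PrimeDivisors p-prime
  open Elimination p-prime
  open Orthogonality p-prime

  private
    p t : ℕ
    p = 2 ℕ.+ n
    t = suc n

  record ResiduePairing {m} (x : Fin m → ℕ) : Set where
    field
      coprime           : ∀ i → ¬ + p ∣ + x i
      partner           : Fin m → Fin m
      partner-≢         : ∀ i → i ≢ partner i
      partner-≡         : ∀ i → + x (partner i) ≡ + x i mod p
      residue-class     : ∀ i j → + x j ≡ + x i mod p → j ≡ i ⊎ j ≡ partner i
      quotients-differ  : ∀ i → ¬ + e₂ p (x i) ≡ + e₂ p (x (partner i)) mod p

  goodMatrix-left : ∀ (xs : Vec ℕ (t ℕ.+ t)) α i a →
    goodMatrix p t xs α i (a Fin.↑ˡ t) ≡ + (lookup xs i ℕ.^ lookup α a)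
  goodMatrix-left xs α i a rewrite FinP.splitAt-↑ˡ t a t = refl

  goodMatrix-right : ∀ (xs : Vec ℕ (t ℕ.+ t)) α i a →
    goodMatrix p t xs α i (t Fin.↑ʳ a) ≡ + (e₂ p (lookup xs i) ℕ.* lookup xs i ℕ.^ lookup α a)
  goodMatrix-right xs α i a rewrite FinP.splitAt-↑ʳ t t a = refl

  -- The two column blocks give l + l′ ≡ 0 and l e + l′ e′ ≡ 0 on each residue class {i, i′}, and e ≢ e′.
  goodMatrix-independent : ∀ (xs : Vec ℕ (t ℕ.+ t)) α → ResiduePairing (lookup xs) →
    (∀ a → lookup α a ≡ toℕ a) → RowsIndependent (t ℕ.+ t) (goodMatrix p t xs α)
  goodMatrix-independent xs α pairing α≡id l combination i =
    ∣⇒≡0-mod (∤-cancelˡ (quotients-differ i ∘ ∣⇒≡mod) (≡0-mod⇒∣ l[e-e′]≡0))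
    where
    open ResiduePairing pairing
    open ≡-mod-Reasoning p
    x : Fin (t ℕ.+ t) → ℕ
    x = lookup xs
    e : Fin (t ℕ.+ t) → ℤ
    e j = + e₂ p (x j)
    power : ∀ j (a : Fin t) → + (x j ℕ.^ lookup α a) ≡ (+ x j) ^ toℕ a
    power j a = trans (cong (λ k → + (x j ℕ.^ k)) (α≡id a)) (pos-^ (x j) (toℕ a))
    left-columns : ∀ (a : Fin t) → ∑ (λ j → l j * (+ x j) ^ toℕ a) ≡ 0ℤ mod p
    left-columns a = begin
      ∑ (λ j → l j * (+ x j) ^ toℕ a)
        ≡⟨ ∑-cong (λ j → cong (l j *_) (sym (trans (goodMatrix-left xs α j a) (power j a)))) ⟩
      ∑ (λ j → l j * goodMatrix p t xs α j (a Fin.↑ˡ t))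
        ≈⟨ combination (a Fin.↑ˡ t) ⟩
      0ℤ ∎
    right-columns : ∀ (a : Fin t) → ∑ (λ j → l j * e j * (+ x j) ^ toℕ a) ≡ 0ℤ mod p
    right-columns a = begin
      ∑ (λ j → l j * e j * (+ x j) ^ toℕ a)               ≈⟨ ∑-cong-mod right-entry ⟩
      ∑ (λ j → l j * goodMatrix p t xs α j (t Fin.↑ʳ a))  ≈⟨ combination (t Fin.↑ʳ a) ⟩
      0ℤ ∎
      where
      right-entry : ∀ j → l j * e j * (+ x j) ^ toℕ a ≡ l j * goodMatrix p t xs α j (t Fin.↑ʳ a) mod p
      right-entry j = begin
        l j * e j * (+ x j) ^ toℕ a                  ≡⟨ ℤP.*-assoc (l j) (e j) _ ⟩
        l j * (e j * (+ x j) ^ toℕ a)                ≡⟨ cong (λ z → l j * (e j * z)) (sym (power j a)) ⟩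
        l j * (e j * + (x j ℕ.^ lookup α a))         ≡⟨ cong (l j *_) (sym (ℤP.pos-* (e₂ p (x j)) _)) ⟩
        l j * + (e₂ p (x j) ℕ.* x j ℕ.^ lookup α a)  ≡⟨ cong (l j *_) (sym (goodMatrix-right xs α j a)) ⟩
        l j * goodMatrix p t xs α j (t Fin.↑ʳ a) ∎
    i′ : Fin (t ℕ.+ t)
    i′ = partner i
    l+l′≡0 : l i + l i′ ≡ 0ℤ mod p
    l+l′≡0 = residue-class-sum x coprime (partner-≢ i) (partner-≡ i) (residue-class i) l left-columns
    le+l′e′≡0 : l i * e i + l i′ * e i′ ≡ 0ℤ mod p
    le+l′e′≡0 =
      residue-class-sum x coprime (partner-≢ i) (partner-≡ i) (residue-class i) (λ j → l j * e j) right-columns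
    l[e-e′]≡0 : (e i - e i′) * l i ≡ 0ℤ mod p
    l[e-e′]≡0 = begin
      (e i - e i′) * l i
        ≡⟨ solve 4 (λ a b e e′ → (e :- e′) :* a := (a :* e :+ b :* e′) :- e′ :* (a :+ b))
                   refl (l i) (l i′) (e i) (e i′) ⟩
      (l i * e i + l i′ * e i′) - e i′ * (l i + l i′)
        ≈⟨ +-cong-mod le+l′e′≡0 (neg-cong-mod (*-cong-mod (refl-mod {a = e i′}) l+l′≡0)) ⟩
      0ℤ - e i′ * 0ℤ
        ≡⟨ cong (λ z → 0ℤ - z) (ℤP.*-zeroʳ (e i′)) ⟩
      0ℤ ∎

module Counting where

  open import Data.Nat using (_+_; _*_; _^_)
  open import Data.Nat.Combinatorics using (_C_; nC1≡n; nCk+nC[k+1]≡[n+1]C[k+1])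
  open import Data.Bool using (Bool; true; false)
  open import Data.List using (List; []; _∷_; _++_; map; length; allFin; cartesianProductWith)
  open import Data.List.Properties using (length-++; length-map; length-tabulate)
  open import Data.List.Membership.Propositional using (_∈_)
  open import Data.List.Membership.Propositional.Properties using (∈-map⁻)
  open import Data.List.Relation.Unary.Unique.Propositional using (Unique)
  import Data.List.Relation.Unary.Unique.Propositional.Properties as Unique
  open import Data.List.Relation.Unary.AllPairs using ([]; _∷_)
  open import Data.List.Relation.Unary.All using ([])
  open import Data.Vec as Vec using (Vec)
  import Data.Vec.Properties as VecP

  length-cartesianProductWith : ∀ {A B C : Set} (f : A → B → C) xs ys →
    length (cartesianProductWith f xs ys) ≡ length xs * length ys
  length-cartesianProductWith f []       ys = refl
  length-cartesianProductWith f (x ∷ xs) ys =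
    trans (length-++ (map (f x) ys)) (cong₂ _+_ (length-map (f x) ys) (length-cartesianProductWith f xs ys))

  vectorsOver : ∀ {A : Set} → List A → ∀ k → List (Vec A k)
  vectorsOver xs zero    = Vec.[] ∷ []
  vectorsOver xs (suc k) = cartesianProductWith Vec._∷_ xs (vectorsOver xs k)

  length-vectorsOver : ∀ {A : Set} (xs : List A) k → length (vectorsOver xs k) ≡ length xs ^ k
  length-vectorsOver xs zero    = refl
  length-vectorsOver xs (suc k) =
    trans (length-cartesianProductWith Vec._∷_ xs (vectorsOver xs k)) (cong (length xs *_) (length-vectorsOver xs k))

  vectorsOver-unique : ∀ {A : Set} {xs : List A} → Unique xs → ∀ k → Unique (vectorsOver xs k)
  vectorsOver-unique unique zero    = [] ∷ []
  vectorsOver-unique unique (suc k) =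
    Unique.cartesianProductWith⁺ Vec._∷_ VecP.∷-injective unique (vectorsOver-unique unique k)

  -- {a < b} ⊆ Fin m, stored as (b , a)
  TwoSubset : ℕ → Set
  TwoSubset m = Σ (Fin m) λ b → Fin (toℕ b)

  element : ∀ {m} → TwoSubset m → Bool → ℕ
  element (b , a) false = toℕ a
  element (b , a) true  = toℕ b

  element<m : ∀ {m} (s : TwoSubset m) side → element s side ℕ.< m
  element<m (b , a) false = ℕP.<-trans (FinP.toℕ<n a) (FinP.toℕ<n b)
  element<m (b , a) true  = FinP.toℕ<n b

  element-injective : ∀ {m} (s : TwoSubset m) {side side′} → element s side ≡ element s side′ → side ≡ side′
  element-injective (b , a) {false} {false} _ = refl
  element-injective (b , a) {false} {true}  e = ⊥-elim (ℕP.<-irrefl e (FinP.toℕ<n a))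
  element-injective (b , a) {true}  {false} e = ⊥-elim (ℕP.<-irrefl (sym e) (FinP.toℕ<n a))
  element-injective (b , a) {true}  {true}  _ = refl

  twoSubset-≡ : ∀ {m} {s s′ : TwoSubset m} → (∀ side → ∃ λ side′ → element s side ≡ element s′ side′) →
    s ≡ s′
  twoSubset-≡ {s = b , a} {b′ , a′} same with same false | same true
  ... | false , a≡a′ | true  , b≡b′ with FinP.toℕ-injective b≡b′
  ...   | refl = cong (b ,_) (FinP.toℕ-injective a≡a′)
  twoSubset-≡ {s = b , a} {b′ , a′} same | false , a≡a′ | false , b≡a′ =
    ⊥-elim (ℕP.<-irrefl (trans a≡a′ (sym b≡a′)) (FinP.toℕ<n a))
  twoSubset-≡ {s = b , a} {b′ , a′} same | true  , a≡b′ | true  , b≡b′ =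
    ⊥-elim (ℕP.<-irrefl (trans a≡b′ (sym b≡b′)) (FinP.toℕ<n a))
  twoSubset-≡ {s = b , a} {b′ , a′} same | true  , a≡b′ | false , b≡a′ =
    ⊥-elim (ℕP.<-asym (subst₂ ℕ._<_ a≡b′ b≡a′ (FinP.toℕ<n a)) (FinP.toℕ<n a′))

  withSmallest : ∀ {m} → Fin m → TwoSubset (suc m)
  withSmallest b = suc b , zero

  shift : ∀ {m} → TwoSubset m → TwoSubset (suc m)
  shift (b , a) = suc b , suc a

  twoSubsets : ∀ m → List (TwoSubset m)
  twoSubsets zero    = []
  twoSubsets (suc m) = map withSmallest (allFin m) ++ map shift (twoSubsets m)

  length-twoSubsets : ∀ m → length (twoSubsets m) ≡ m C 2
  length-twoSubsets zero    = refl
  length-twoSubsets (suc m) = begin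
    length (map withSmallest (allFin m) ++ map shift (twoSubsets m))
      ≡⟨ length-++ (map withSmallest (allFin m)) ⟩
    length (map withSmallest (allFin m)) + length (map shift (twoSubsets m))
      ≡⟨ cong₂ _+_ (trans (length-map withSmallest (allFin m)) (length-tabulate id))
                   (trans (length-map shift (twoSubsets m)) (length-twoSubsets m)) ⟩
    m + m C 2      ≡⟨ cong (_+ m C 2) (sym (nC1≡n m)) ⟩
    m C 1 + m C 2  ≡⟨ nCk+nC[k+1]≡[n+1]C[k+1] m 1 ⟩
    suc m C 2      ∎
    where open ≡-Reasoning

  twoSubsets-unique : ∀ m → Unique (twoSubsets m)
  twoSubsets-unique zero    = []
  twoSubsets-unique (suc m) = Unique.++⁺ (Unique.map⁺ withSmallest-injective (Unique.allFin⁺ m))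
                                         (Unique.map⁺ shift-injective (twoSubsets-unique m)) disjoint
    where
    withSmallest-injective : ∀ {b b′ : Fin m} → withSmallest b ≡ withSmallest b′ → b ≡ b′
    withSmallest-injective refl = refl
    shift-injective : ∀ {s s′ : TwoSubset m} → shift s ≡ shift s′ → s ≡ s′
    shift-injective refl = refl
    disjoint : ∀ {s} → ¬ (s ∈ map withSmallest (allFin m) × s ∈ map shift (twoSubsets m))
    disjoint (s∈new , s∈shifted) with ∈-map⁻ withSmallest s∈new | ∈-map⁻ shift s∈shifted
    ... | b , _ , refl | s′ , _ , ()

module SortedVectors where

  open import Data.List using (List; []; _∷_; length)
  open import Data.List.Membership.Propositional using (_∈_)
  open import Data.List.Relation.Unary.Any using (here; there)
  open import Data.List.Relation.Unary.All as All using ()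
  open import Data.List.Relation.Unary.AllPairs as AllPairs using (AllPairs; _∷_)
  open import Data.List.Relation.Unary.Linked.Properties using (Linked⇒AllPairs)
  open import Data.List.Relation.Unary.Unique.Propositional using (Unique)
  open import Data.List.Relation.Binary.Permutation.Propositional using (↭-sym; ↭⇒↭ₛ)
  open import Data.List.Relation.Binary.Permutation.Propositional.Properties using (∈-resp-↭; ↭-length)
  import Data.List.Relation.Binary.Permutation.Setoid.Properties (setoid ℕ) as Permutationₛ
  open import Data.List.Sort ℕP.≤-decTotalOrder using (sort; sort-↭; sort-↗)
  open import Data.Vec using (Vec; []; _∷_; lookup)

  toVec : ∀ (l : List ℕ) {m} → length l ≡ m → Vec ℕ m
  toVec []      refl = []
  toVec (x ∷ l) refl = x ∷ toVec l refl

  toVec-∈ : ∀ l {m} (e : length l ≡ m) i → lookup (toVec l e) i ∈ l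
  toVec-∈ (x ∷ l) refl zero    = here refl
  toVec-∈ (x ∷ l) refl (suc i) = there (toVec-∈ l refl i)

  toVec-∋ : ∀ l {m} (e : length l ≡ m) {v} → v ∈ l → ∃ λ i → lookup (toVec l e) i ≡ v
  toVec-∋ (x ∷ l) refl (here refl) = zero , refl
  toVec-∋ (x ∷ l) refl (there v∈l) = let i , e = toVec-∋ l refl v∈l in suc i , e

  toVec-increasing : ∀ {l} {m} (e : length l ≡ m) → AllPairs ℕ._<_ l → Increasing (toVec l e)
  toVec-increasing {x ∷ l} refl (x< ∷ _) zero    (suc j) _         = All.lookup x< (toVec-∈ l refl j)
  toVec-increasing {x ∷ l} refl (_ ∷ l<) (suc i) (suc j) (s≤s i<j) = toVec-increasing refl l< i j i<j

  sortVec : ∀ (l : List ℕ) {m} → length l ≡ m → Vec ℕ m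
  sortVec l e = toVec (sort l) (trans (↭-length (sort-↭ l)) e)

  sortVec-∈ : ∀ l {m} (e : length l ≡ m) i → lookup (sortVec l e) i ∈ l
  sortVec-∈ l e i = ∈-resp-↭ (sort-↭ l) (toVec-∈ (sort l) _ i)

  sortVec-∋ : ∀ l {m} (e : length l ≡ m) {v} → v ∈ l → ∃ λ i → lookup (sortVec l e) i ≡ v
  sortVec-∋ l e v∈l = toVec-∋ (sort l) _ (∈-resp-↭ (↭-sym (sort-↭ l)) v∈l)

  sortVec-increasing : ∀ {l} {m} (e : length l ≡ m) → Unique l → Increasing (sortVec l e)
  sortVec-increasing {l} e unique = toVec-increasing _
    (AllPairs.zipWith (λ (≤ , ≢) → ℕP.≤∧≢⇒< ≤ ≢)
      (Linked⇒AllPairs ℕP.≤-trans (sort-↗ l) , Permutationₛ.Unique-resp-↭ (↭⇒↭ₛ (↭-sym (sort-↭ l))) unique))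

module LiftSets {n : ℕ} (p-prime : Prime (2 ℕ.+ n)) where

  open import Data.Bool using (Bool; true; false; not)
  open import Data.Bool.Properties using (not-¬)
  import Data.Sum as Sum
  open import Data.Integer using (_-_)
  open import Data.Integer.Divisibility.Signed using (_∣_; ∣n⇒∣m*n; ∣-refl; ∣ᵤ⇒∣)
  open import Data.Integer.Solver using (module +-*-Solver)
  open import Data.List using (List; []; _∷_; length; allFin; cartesianProductWith)
  open import Data.List.Properties using (length-tabulate)
  open import Data.Nat.Combinatorics using (_C_)
  open import Data.List.Membership.Propositional using (_∈_)
  open import Data.List.Membership.Propositional.Properties
    using (∈-cartesianProductWith⁺; ∈-cartesianProductWith⁻; ∈-allFin)
  open import Data.List.Relation.Unary.Any using (here; there)
  open import Data.List.Relation.Unary.Unique.Propositional using (Unique)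
  open import Data.List.Relation.Unary.AllPairs using ([]; _∷_)
  open import Data.List.Relation.Unary.All using ([]; _∷_)
  import Data.List.Relation.Unary.Unique.Propositional.Properties as Unique
  open import Data.Vec using (Vec; lookup)
  import Data.Vec.Properties as VecP
  open +-*-Solver
  open Congruence
  open Counting
  open SortedVectors
  open IncreasingVectors
  open PrimeDivisors p-prime
  open FermatQuotient p-prime
  open Elimination p-prime
  open GoodMatrices p-prime

  private
    p t : ℕ
    p = 2 ℕ.+ n
    t = suc n

  lift : Fin t → ℕ → ℕ
  lift j k = suc (toℕ j) ℕ.+ k ℕ.* p

  residue<p : ∀ (j : Fin t) → suc (toℕ j) ℕ.< p
  residue<p j = s≤s (FinP.toℕ<n j)

  lift≡residue : ∀ j k → + lift j k ≡ + suc (toℕ j) mod p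
  lift≡residue j k = ∣⇒≡mod (subst (+ p ∣_) (sym difference) (∣n⇒∣m*n (+ k) ∣-refl))
    where
    difference : + lift j k - + suc (toℕ j) ≡ + k ℤ.* + p
    difference = begin
      + (suc (toℕ j) ℕ.+ k ℕ.* p) - + suc (toℕ j)
        ≡⟨ cong (_- + suc (toℕ j))
                (trans (ℤP.pos-+ (suc (toℕ j)) (k ℕ.* p)) (cong (ℤ._+_ (+ suc (toℕ j))) (ℤP.pos-* k p))) ⟩
      (+ suc (toℕ j) ℤ.+ + k ℤ.* + p) - + suc (toℕ j)
        ≡⟨ solve 3 (λ r k p → (r :+ k :* p) :- r := k :* p) refl (+ suc (toℕ j)) (+ k) (+ p) ⟩
      + k ℤ.* + p ∎
      where open ≡-Reasoning

  lift-coprime : ∀ j k → ¬ + p ∣ + lift j k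
  lift-coprime j k p∣lift = ∤-positive (s≤s z≤n) (residue<p j) (∣-resp-mod (lift≡residue j k) p∣lift)

  lift-residue-injective : ∀ {j j′ k k′} → + lift j k ≡ + lift j′ k′ mod p → j ≡ j′
  lift-residue-injective {j} {j′} {k} {k′} same = FinP.toℕ-injective (ℕP.suc-injective
    (≡mod⇒≡-below (residue<p j) (residue<p j′)
                  (trans-mod (sym-mod (lift≡residue j k)) (trans-mod same (lift≡residue j′ k′)))))

  lift-injective : ∀ {j j′ k k′} → lift j k ≡ lift j′ k′ → j ≡ j′ × k ≡ k′
  lift-injective {j} {j′} {k} {k′} e =
    j≡j′ , ℕP.*-cancelʳ-≡ k k′ p
             (ℕP.+-cancelˡ-≡ (suc (toℕ j)) (k ℕ.* p) (k′ ℕ.* p) (trans e (cong (λ i → lift i k′) (sym j≡j′))))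
    where
    j≡j′ : j ≡ j′
    j≡j′ = lift-residue-injective {j} {j′} {k} {k′} (reflexive-mod (cong +_ e))

  lift<p² : ∀ j {k} → k ℕ.< p → lift j k ℕ.< p ℕ.* p
  lift<p² j {k} k<p = ℕP.<-≤-trans (ℕP.+-monoˡ-< (k ℕ.* p) (residue<p j)) (ℕP.*-monoˡ-≤ p k<p)

  Choice : Set
  Choice = Vec (TwoSubset p) t

  chosenLift : Choice → Fin t → Bool → ℕ
  chosenLift c j side = lift j (element (lookup c j) side)

  chosenLift-injective : ∀ c {j j′ side side′} → chosenLift c j side ≡ chosenLift c j′ side′ →
    j ≡ j′ × side ≡ side′
  chosenLift-injective c {j} {j′} {side} {side′} e =
    let j≡j′ , same-element = lift-injective {j} {j′} {element (lookup c j) side} {element (lookup c j′) side′} e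
    in j≡j′ , element-injective (lookup c j) (trans same-element (cong (λ i → element (lookup c i) side′) (sym j≡j′)))

  ≡⊎≡not : ∀ b b′ → b′ ≡ b ⊎ b′ ≡ not b
  ≡⊎≡not false false = inj₁ refl
  ≡⊎≡not false true  = inj₂ refl
  ≡⊎≡not true  false = inj₂ refl
  ≡⊎≡not true  true  = inj₁ refl

  sides : List Bool
  sides = false ∷ true ∷ []

  ∈-sides : ∀ side → side ∈ sides
  ∈-sides false = here refl
  ∈-sides true  = there (here refl)

  chosenLifts : Choice → List ℕ
  chosenLifts c = cartesianProductWith (chosenLift c) (allFin t) sides

  length-chosenLifts : ∀ c → length (chosenLifts c) ≡ t ℕ.+ t
  length-chosenLifts c = begin
    length (chosenLifts c)   ≡⟨ length-cartesianProductWith (chosenLift c) (allFin t) sides ⟩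
    length (allFin t) ℕ.* 2  ≡⟨ cong (ℕ._* 2) (length-tabulate {n = t} (λ i → i)) ⟩
    t ℕ.* 2                  ≡⟨ trans (ℕP.*-comm t 2) (cong (t ℕ.+_) (ℕP.+-identityʳ t)) ⟩
    t ℕ.+ t                  ∎
    where open ≡-Reasoning

  chosenLifts-unique : ∀ c → Unique (chosenLifts c)
  chosenLifts-unique c = Unique.cartesianProductWith⁺ (chosenLift c) (chosenLift-injective c) (Unique.allFin⁺ t) sides-unique
    where
    sides-unique : Unique sides
    sides-unique = ((λ ()) ∷ []) ∷ [] ∷ []

  startingSet : Choice → Vec ℕ (t ℕ.+ t)
  startingSet c = sortVec (chosenLifts c) (length-chosenLifts c)

  entry-is-chosen : ∀ c i → ∃ λ j → ∃ λ side → lookup (startingSet c) i ≡ chosenLift c j side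
  entry-is-chosen c i
    with ∈-cartesianProductWith⁻ (chosenLift c) (allFin t) sides (sortVec-∈ (chosenLifts c) (length-chosenLifts c) i)
  ... | j , side , _ , _ , e = j , side , e

  chosen-is-entry : ∀ c j side → ∃ λ i → lookup (startingSet c) i ≡ chosenLift c j side
  chosen-is-entry c j side = sortVec-∋ (chosenLifts c) (length-chosenLifts c)
    (∈-cartesianProductWith⁺ (chosenLift c) (∈-allFin j) (∈-sides side))

  startingSet-increasing : ∀ c → Increasing (startingSet c)
  startingSet-increasing c = sortVec-increasing (length-chosenLifts c) (chosenLifts-unique c)

  startingSet-bounded : ∀ c i → 1 ℕ.≤ lookup (startingSet c) i × lookup (startingSet c) i ℕ.< p ℕ.* p
  startingSet-bounded c i with entry-is-chosen c i
  ... | j , side , e rewrite e = s≤s z≤n , lift<p² j (element<m (lookup c j) side)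

  startingSet-injective : ∀ {c c′} → startingSet c ≡ startingSet c′ → c ≡ c′
  startingSet-injective {c} {c′} xs≡xs′ =
    trans (sym (VecP.tabulate∘lookup c)) (trans (VecP.tabulate-cong same-subset) (VecP.tabulate∘lookup c′))
    where
    same-subset : ∀ j → lookup c j ≡ lookup c′ j
    same-subset j = twoSubset-≡ λ side →
      let i , x≡ = chosen-is-entry c j side
          j′ , side′ , x≡′ = entry-is-chosen c′ i
          j≡j′ , k≡k′ = lift-injective (trans (sym x≡) (trans (cong (λ xs → lookup xs i) xs≡xs′) x≡′))
      in side′ , subst (λ j′ → element (lookup c j) side ≡ element (lookup c′ j′) side′) (sym j≡j′) k≡k′

  module StartingSetPairing (c : Choice) where

    xs : Vec ℕ (t ℕ.+ t)
    xs = startingSet c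

    class : Fin (t ℕ.+ t) → Fin t
    class i = proj₁ (entry-is-chosen c i)

    side : Fin (t ℕ.+ t) → Bool
    side i = proj₁ (proj₂ (entry-is-chosen c i))

    chosen : Fin (t ℕ.+ t) → Bool → ℕ
    chosen i = element (lookup c (class i))

    entry≡chosen : ∀ i → lookup xs i ≡ chosenLift c (class i) (side i)
    entry≡chosen i = proj₂ (proj₂ (entry-is-chosen c i))

    partner : Fin (t ℕ.+ t) → Fin (t ℕ.+ t)
    partner i = proj₁ (chosen-is-entry c (class i) (not (side i)))

    partner≡chosen : ∀ i → lookup xs (partner i) ≡ chosenLift c (class i) (not (side i))
    partner≡chosen i = proj₂ (chosen-is-entry c (class i) (not (side i)))

    partner-≡ : ∀ i → + lookup xs (partner i) ≡ + lookup xs i mod p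
    partner-≡ i = begin
      + lookup xs (partner i)                    ≡⟨ cong +_ (partner≡chosen i) ⟩
      + chosenLift c (class i) (not (side i))    ≈⟨ lift≡residue (class i) (chosen i (not (side i))) ⟩
      + suc (toℕ (class i))                      ≈⟨ sym-mod (lift≡residue (class i) (chosen i (side i))) ⟩
      + chosenLift c (class i) (side i)          ≡⟨ cong +_ (sym (entry≡chosen i)) ⟩
      + lookup xs i                              ∎
      where open ≡-mod-Reasoning p

    partner-≢ : ∀ i → i ≢ partner i
    partner-≢ i i≡partner = not-¬ {side i} refl (proj₂ (chosenLift-injective c {class i} {class i} {side i} {not (side i)}
      (trans (sym (entry≡chosen i)) (trans (cong (lookup xs) i≡partner) (partner≡chosen i)))))

    residue-class : ∀ i i′ → + lookup xs i′ ≡ + lookup xs i mod p → i′ ≡ i ⊎ i′ ≡ partner i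
    residue-class i i′ same = Sum.map (λ e → injective (trans x′≡ (trans (cong (chosenLift c (class i)) e) (sym (entry≡chosen i)))))
                                      (λ e → injective (trans x′≡ (trans (cong (chosenLift c (class i)) e) (sym (partner≡chosen i)))))
                                      (≡⊎≡not (side i) (side i′))
      where
      injective : ∀ {i j} → lookup xs i ≡ lookup xs j → i ≡ j
      injective = increasing⇒injective xs (startingSet-increasing c)
      same-class : class i′ ≡ class i
      same-class = lift-residue-injective {class i′} {class i} {chosen i′ (side i′)} {chosen i (side i)}
        (trans-mod (reflexive-mod (cong +_ (sym (entry≡chosen i′)))) (trans-mod same (reflexive-mod (cong +_ (entry≡chosen i)))))
      x′≡ : lookup xs i′ ≡ chosenLift c (class i) (side i′)
      x′≡ = trans (entry≡chosen i′) (cong (λ j → chosenLift c j (side i′)) same-class)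

    quotients-differ : ∀ i → ¬ + e₂ p (lookup xs i) ≡ + e₂ p (lookup xs (partner i)) mod p
    quotients-differ i e≡e′ = not-¬ {side i} refl (element-injective (lookup c (class i))
      (e₂-lifts-distinct {suc (toℕ (class i))} {chosen i (side i)} {chosen i (not (side i))}
        (∤-positive (s≤s z≤n) (residue<p (class i)))
        (element<m (lookup c (class i)) (side i)) (element<m (lookup c (class i)) (not (side i)))
        (subst₂ (λ u v → + e₂ p u ≡ + e₂ p v mod p) (entry≡chosen i) (partner≡chosen i) e≡e′)))

    pairing : ResiduePairing (lookup xs)
    pairing = record
      { coprime          = λ i → subst (λ v → ¬ + p ∣ + v) (sym (entry≡chosen i)) (lift-coprime (class i) (chosen i (side i)))
      ; partner          = partner
      ; partner-≢        = partner-≢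
      ; partner-≡        = partner-≡
      ; residue-class    = residue-class
      ; quotients-differ = quotients-differ
      }

  startingSet-pairing : ∀ c → ResiduePairing (lookup (startingSet c))
  startingSet-pairing = StartingSetPairing.pairing

  startingSet-good : ∀ c → GoodStartingSet p t (startingSet c)
  startingSet-good c α increasing bounded p∣det =
    independent⇒det≢0 (t ℕ.+ t) (goodMatrix p t (startingSet c) α)
      (goodMatrix-independent (startingSet c) α (startingSet-pairing c) (increasing-bounded⇒identity α increasing bounded))
      (∣ᵤ⇒∣ p∣det)

  choices : List Choice
  choices = vectorsOver (twoSubsets p) t

  choices-unique : Unique choices
  choices-unique = vectorsOver-unique (twoSubsets-unique p) t

  length-choices : length choices ≡ (p C 2) ℕ.^ t
  length-choices = trans (length-vectorsOver (twoSubsets p) t) (cong (ℕ._^ t) (length-twoSubsets p))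

open import Data.Nat using (_+_; _*_; _∸_; _^_; _≤_; _<_)
open import Data.Nat.Combinatorics using (_C_)
open import Data.Vec using (Vec; lookup)
open import Data.List using (List; length; map)
open import Data.List.Relation.Unary.All using (All)
open import Data.List.Relation.Unary.Unique.Propositional using (Unique)

proposition1p18 : (p : ℕ) → Prime p → 2 < p →
    Σ (List (Vec ℕ ((p ∸ 1) + (p ∸ 1)))) λ L →
      Unique L
      × All (λ xs → Increasing xs
                    × (∀ i → 1 ≤ lookup xs i × lookup xs i < p * p)
                    × GoodStartingSet p (p ∸ 1) xs) L
      × (p C 2) ^ (p ∸ 1) ≤ length L
proposition1p18 p@(suc (suc (suc n))) p-prime (s≤s (s≤s (s≤s z≤n))) =
  map startingSet choices ,
  Unique.map⁺ startingSet-injective choices-unique ,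
  All.map⁺ (All.tabulate λ {c} _ → startingSet-increasing c , startingSet-bounded c , startingSet-good c) ,
  ℕP.≤-reflexive (sym (trans (length-map startingSet choices) length-choices))
  where
  import Data.List.Relation.Unary.Unique.Propositional.Properties as Unique
  import Data.List.Relation.Unary.All as All
  import Data.List.Relation.Unary.All.Properties as All
  open import Data.List.Properties using (length-map)
  open LiftSets p-prime
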